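{- For every integer $s \geqslant 2$, the graph $K_{8s+1} - K_4$ has a quadrangular embedding in the closed orientable surface $S_{8s^2-3s-1}$.
   Context: $K_p - K_i$ denotes the graph obtained from the complete graph $K_p$ by deleting all edges of a fixed complete subgraph $K_i$ (keeping all vertices). A quadrangular embedding is a 2-cell embedding in which every face has length exactly $4$. $S_h$ denotes the closed orientable surface of genus $h$. -}

module Defs where

open import Data.Nat using (ℕ; zero; suc; _+_; _*_; _<_; _≤_; _<?_; _≤?_)
open import Data.Fin using (Fin; toℕ)
open import Data.Fin.Properties using () renaming (_≟_ to _≟ᶠ_)
open import Data.Product using (Σ; ∃-syntax; _×_; _,_; proj₁; proj₂)
open import Data.Product.Properties using () renaming (≡-dec to ×-≡-dec)
open import Data.List using (List; length; filter; upTo; allFin; cartesianProduct)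
open import Data.List.Relation.Unary.All using (All; all?)
open import Function using (_∘_)
open import Relation.Binary.PropositionalEquality using (_≡_; _≢_)
open import Relation.Nullary using (¬_; Dec)
open import Relation.Nullary.Decidable using (_×-dec_; ¬?)

-- Vertices of K_p are Fin p.  The deleted complete subgraph K_i is the one
-- spanned by the vertices 0, …, i-1.  Adjacency in K_p - K_i:
-- u ≠ v, and not both u and v lie in the deleted K_i.
Adj : (p i : ℕ) → Fin p → Fin p → Set
Adj p i u v = (u ≢ v) × ¬ (toℕ u < i × toℕ v < i)

Adj? : (p i : ℕ) → (u v : Fin p) → Dec (Adj p i u v)
Adj? p i u v = ¬? (u ≟ᶠ v) ×-dec ¬? ((toℕ u <? i) ×-dec (toℕ v <? i))

iter : ∀ {A : Set} → (A → A) → ℕ → A → A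
iter f zero    x = x
iter f (suc k) x = f (iter f k x)

-- A rotation system (pure rotation system = 2-cell embedding into a closed
-- orientable surface) of K_p - K_i: for each vertex u, rot u is a cyclic
-- permutation of the neighbourhood N(u) (values outside N(u) are irrelevant).
record RotationSystem (p i : ℕ) : Set where
  field
    rot        : Fin p → Fin p → Fin p
    rot-adj    : ∀ u v → Adj p i u v → Adj p i u (rot u v)
    rot-inj    : ∀ u v w → Adj p i u v → Adj p i u w → rot u v ≡ rot u w → v ≡ w
    rot-cyclic : ∀ u v w → Adj p i u v → Adj p i u w → ∃[ k ] iter (rot u) k v ≡ w

numEdges : (p i : ℕ) → ℕ
numEdges p i = length (filter (λ d → Adj? p i (proj₁ d) (proj₂ d) ×-dec (toℕ (proj₁ d) <? toℕ (proj₂ d)))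
                              (cartesianProduct (allFin p) (allFin p)))

Dart : ℕ → Set
Dart p = Fin p × Fin p

module _ {p i : ℕ} (R : RotationSystem p i) where
  open RotationSystem R

  -- face-tracing permutation on darts: (u , v) ↦ (v , rot v u)
  φ : Dart p → Dart p
  φ (u , v) = v , rot v u

  IsDart : Dart p → Set
  IsDart (u , v) = Adj p i u v

  isDart? : (d : Dart p) → Dec (IsDart d)
  isDart? (u , v) = Adj? p i u v

  Quadrangular : Set
  Quadrangular = ∀ d → IsDart d →
    (iter φ 4 d ≡ d) × (∀ k → 0 < k → k < 4 → iter φ k d ≢ d)

  code : Dart p → ℕ
  code (u , v) = toℕ u * p + toℕ v

  -- d is the representative (least code) of its φ-orbit; orbits have length ≤ p*p
  OrbitMin : Dart p → Set
  OrbitMin d = All (λ k → code d ≤ code (iter φ k d)) (upTo (p * p))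

  orbitMin? : (d : Dart p) → Dec (OrbitMin d)
  orbitMin? d = all? (λ k → code d ≤? code (iter φ k d)) (upTo (p * p))

  allDarts : List (Dart p)
  allDarts = cartesianProduct (allFin p) (allFin p)

  numFaces : ℕ
  numFaces = length (filter (λ d → isDart? d ×-dec orbitMin? d) allDarts)

  -- the embedding lies in S_h iff  V - E + F = 2 - 2h
  EmbeddedInGenus : ℕ → Set
  EmbeddedInGenus h = p + numFaces + 2 * h ≡ numEdges p i + 2

-- The embedding is the derived embedding of an index-one current graph with four vortices,
-- the vertices of the deleted K₄. The remaining n = 8s − 3 vertices form ℤₙ; all of them carry
-- the same rotation σ, a cyclic order of the currents ±1, …, ±(n − 1)/2 and of the four vortices
-- (the neighbour of w along the current c is w + c), and each vortex rotates ℤₙ by w ↦ w ± 1.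
-- Tracing a face replaces the current c of a dart by σ(−c), so the embedding is quadrangular
-- as soon as every orbit of c ↦ σ(−c) has length 4 and current sum 0 in ℤ: σ is chosen so that
-- these orbits are explicit squares. Counting darts then gives 4F = 2E = n(n + 7), and Euler's
-- formula yields the genus 8s² − 3s − 1.

{-# OPTIONS --safe #-}
module Submission where

open import Defs
open import Data.Nat hiding (_≟_)
open import Data.Nat using () renaming (_≟_ to _≟ℕ_)
open import Data.Nat.Properties hiding (_≟_; suc-injective)
open import Data.Nat.DivMod using (_mod_; m%n<n; %-distribˡ-+; m%n%n≡m%n; [m+kn]%n≡m%n; [m+n]%n≡m%n; m<n⇒m%n≡m; n%n≡0)
open import Data.Nat.Tactic.RingSolver using (solve-∀)
open import Data.Fin using (Fin; zero; suc; toℕ; combine; remQuot)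
open import Data.Fin.Properties using (_≟_; suc-injective; toℕ<n; toℕ-injective; toℕ-fromℕ<; toℕ-combine; remQuot-combine)
open import Data.Product using (Σ; ∃-syntax; _×_; _,_; proj₁; proj₂; uncurry)
open import Data.Product.Properties using () renaming (≡-dec to ×-≡-dec)
open import Data.Sum using (_⊎_; inj₁; inj₂)
open import Data.Unit using (⊤; tt)
open import Data.Empty using (⊥; ⊥-elim)
open import Data.Bool using (true; false; if_then_else_)
open import Data.List using (List; []; _∷_; _++_; map; length; filter; allFin; cartesianProduct)
open import Data.List.Properties using (map-tabulate)
open import Data.List.Relation.Unary.All as All using ()
open import Data.List.Membership.Propositional.Properties using (∈-upTo⁺)
open import Function using (_∘_; id)
open import Level using (0ℓ)
open import Relation.Nullary using (¬_; Dec; yes; no; does)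
open import Relation.Nullary.Decidable using (_×-dec_)
open import Relation.Unary using (Pred; Decidable)
open import Relation.Binary using (tri<; tri≈; tri>; DecidableEquality)
open import Relation.Binary.PropositionalEquality
open import Algebra.Properties.CommutativeSemigroup +-commutativeSemigroup using () renaming (interchange to +-interchange)

-- Iteration and cyclic permutations

module _ {A : Set} (f : A → A) where

  iter-+ : ∀ m k x → iter f (m + k) x ≡ iter f m (iter f k x)
  iter-+ zero    k x = refl
  iter-+ (suc m) k x = cong f (iter-+ m k x)

  iter-sucʳ : ∀ k x → iter f (suc k) x ≡ iter f k (f x)
  iter-sucʳ zero    x = refl
  iter-sucʳ (suc k) x = cong f (iter-sucʳ k x)

  iter-periodic : ∀ {T x} → iter f T x ≡ x → ∀ m → iter f (m * T) x ≡ x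
  iter-periodic         per zero    = refl
  iter-periodic {T} {x} per (suc m) = begin
    iter f (T + m * T) x        ≡⟨ iter-+ T (m * T) x ⟩
    iter f T (iter f (m * T) x) ≡⟨ cong (iter f T) (iter-periodic per m) ⟩
    iter f T x                  ≡⟨ per ⟩
    x                           ∎
    where open ≡-Reasoning

module Reachability {A : Set} (f : A → A) where

  infix 4 _↝_
  _↝_ : A → A → Set
  x ↝ y = ∃[ k ] iter f k x ≡ y

  ↝-refl : ∀ {x} → x ↝ x
  ↝-refl = 0 , refl

  ↝-trans : ∀ {x y z} → x ↝ y → y ↝ z → x ↝ z
  ↝-trans {x} (k , fᵏx≡y) (m , fᵐy≡z) = m + k , trans (iter-+ f m k x) (trans (cong (iter f m) fᵏx≡y) fᵐy≡z)

  infixl 5 _▸_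
  _▸_ : ∀ {x y z} → x ↝ y → f y ≡ z → x ↝ z
  (k , fᵏx≡y) ▸ fy≡z = suc k , trans (cong f fᵏx≡y) fy≡z

  ↝-return : ∀ {b x} → ∃[ T ] iter f (suc T) b ≡ b → b ↝ x → x ↝ b
  ↝-return {b} (T , per) (k , refl) = T * k , (begin
    iter f (T * k) (iter f k b)  ≡⟨ iter-+ f (T * k) k b ⟨
    iter f (T * k + k) b         ≡⟨ cong (λ t → iter f t b) (trans (+-comm (T * k) k) (*-comm (suc T) k)) ⟩
    iter f (k * suc T) b         ≡⟨ iter-periodic f per k ⟩
    b                            ∎)
    where open ≡-Reasoning

record CyclicOn {A : Set} (P : A → Set) (f : A → A) : Set where
  field
    closed    : ∀ x → P x → P (f x)
    injective : ∀ x y → P x → P y → f x ≡ f y → x ≡ y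
    connected : ∀ x y → P x → P y → ∃[ k ] iter f k x ≡ y

module _ {A : Set} {P : A → Set} {f : A → A} where
  open Reachability f

  cyclicOn-fromBase : ∀ {g b} → (∀ x → P x → P (f x)) → (∀ x → P x → g (f x) ≡ x) →
    ∃[ T ] iter f (suc T) b ≡ b → (∀ x → P x → b ↝ x) → CyclicOn P f
  cyclicOn-fromBase {g} {b} closed inverse per reach = record
    { closed    = closed
    ; injective = λ x y px py fx≡fy →
        trans (sym (inverse x px)) (trans (cong g fx≡fy) (inverse y py))
    ; connected = λ x y px py → ↝-trans (↝-return per (reach x px)) (reach y py)
    }

  cyclicOn-transport : ∀ {B : Set} {Q : B → Set} (to : A → B) (from : B → A) →
    (∀ a → P a → Q (to a)) → (∀ b → Q b → P (from b)) →
    (∀ a → P a → from (to a) ≡ a) → (∀ b → Q b → to (from b) ≡ b) →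
    CyclicOn P f → CyclicOn Q (λ b → to (f (from b)))
  cyclicOn-transport {B = B} {Q = Q} to from to-Q from-P from-to to-from cyc = record
    { closed    = λ b qb → to-Q _ (closed _ (from-P b qb))
    ; injective = λ b b′ qb qb′ eq →
        trans (sym (to-from b qb))
          (trans (cong to (injective _ _ (from-P b qb) (from-P b′ qb′) (untransport b b′ qb qb′ eq)))
                 (to-from b′ qb′))
    ; connected = λ b b′ qb qb′ →
        let k , fᵏ = connected _ _ (from-P b qb) (from-P b′ qb′)
        in k , trans (iter-conj b qb k) (trans (cong to fᵏ) (to-from b′ qb′))
    }
    where
    open CyclicOn cyc
    g : B → B
    g b = to (f (from b))
    from-g : ∀ b → Q b → from (g b) ≡ f (from b)
    from-g b qb = from-to _ (closed _ (from-P b qb))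
    untransport : ∀ b b′ → Q b → Q b′ → g b ≡ g b′ → f (from b) ≡ f (from b′)
    untransport b b′ qb qb′ eq = trans (sym (from-g b qb)) (trans (cong from eq) (from-g b′ qb′))
    iter-closed : ∀ k a → P a → P (iter f k a)
    iter-closed zero    a pa = pa
    iter-closed (suc k) a pa = closed _ (iter-closed k a pa)
    iter-conj : ∀ b → Q b → ∀ k → iter g k b ≡ to (iter f k (from b))
    iter-conj b qb zero    = sym (to-from b qb)
    iter-conj b qb (suc k) = trans (cong g (iter-conj b qb k))
                                   (cong (λ a → to (f a)) (from-to _ (iter-closed k _ (from-P b qb))))

module _ {A : Set} {f g : A → A} (g∘f : ∀ x → g (f x) ≡ x) where
  iter-inverse : ∀ k x → iter g k (iter f k x) ≡ x
  iter-inverse zero    x = refl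
  iter-inverse (suc k) x = trans (iter-sucʳ g k (f (iter f k x)))
                                 (trans (cong (iter g k) (g∘f (iter f k x))) (iter-inverse k x))

  reach-inverse : ∀ {x y} → ∃[ k ] iter f k y ≡ x → ∃[ k ] iter g k x ≡ y
  reach-inverse {y = y} (k , refl) = k , iter-inverse k y

toRotationSystem : ∀ {p i} (rot : Fin p → Fin p → Fin p) →
  (∀ u → CyclicOn (Adj p i u) (rot u)) → RotationSystem p i
toRotationSystem rot cyc = record
  { rot        = rot
  ; rot-adj    = λ u → CyclicOn.closed (cyc u)
  ; rot-inj    = λ u → CyclicOn.injective (cyc u)
  ; rot-cyclic = λ u → CyclicOn.connected (cyc u)
  }

-- Finite sums

∑ : {A : Set} → List A → (A → ℕ) → ℕ
∑ []       f = 0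
∑ (x ∷ xs) f = f x + ∑ xs f

private variable A B : Set

∑-cong : ∀ xs {f g : A → ℕ} → (∀ x → f x ≡ g x) → ∑ xs f ≡ ∑ xs g
∑-cong []       f≗g = refl
∑-cong (x ∷ xs) f≗g = cong₂ _+_ (f≗g x) (∑-cong xs f≗g)

∑-zero : ∀ (xs : List A) → ∑ xs (λ _ → 0) ≡ 0
∑-zero []       = refl
∑-zero (x ∷ xs) = ∑-zero xs

∑-+ : ∀ xs (f g : A → ℕ) → ∑ xs (λ x → f x + g x) ≡ ∑ xs f + ∑ xs g
∑-+ []       f g = refl
∑-+ (x ∷ xs) f g = trans (cong (f x + g x +_) (∑-+ xs f g)) (+-interchange (f x) (g x) _ _)

∑-*ˡ : ∀ xs c (f : A → ℕ) → ∑ xs (λ x → c * f x) ≡ c * ∑ xs f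
∑-*ˡ []       c f = sym (*-zeroʳ c)
∑-*ˡ (x ∷ xs) c f = trans (cong (c * f x +_) (∑-*ˡ xs c f)) (sym (*-distribˡ-+ c (f x) (∑ xs f)))

∑-++ : ∀ xs ys (f : A → ℕ) → ∑ (xs ++ ys) f ≡ ∑ xs f + ∑ ys f
∑-++ []       ys f = refl
∑-++ (x ∷ xs) ys f = trans (cong (f x +_) (∑-++ xs ys f)) (sym (+-assoc (f x) (∑ xs f) (∑ ys f)))

∑-map : ∀ (g : A → B) xs (f : B → ℕ) → ∑ (map g xs) f ≡ ∑ xs (f ∘ g)
∑-map g []       f = refl
∑-map g (x ∷ xs) f = cong (f (g x) +_) (∑-map g xs f)

∑-cartesianProduct : ∀ (xs : List A) (ys : List B) f →
  ∑ (cartesianProduct xs ys) f ≡ ∑ xs (λ x → ∑ ys (λ y → f (x , y)))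
∑-cartesianProduct []       ys f = refl
∑-cartesianProduct (x ∷ xs) ys f =
  trans (∑-++ (map (x ,_) ys) _ f) (cong₂ _+_ (∑-map (x ,_) ys f) (∑-cartesianProduct xs ys f))

∑-comm : ∀ (xs : List A) (ys : List B) (f : A → B → ℕ) →
  ∑ xs (λ x → ∑ ys (f x)) ≡ ∑ ys (λ y → ∑ xs (λ x → f x y))
∑-comm []       ys f = sym (∑-zero ys)
∑-comm (x ∷ xs) ys f =
  trans (cong (∑ ys (f x) +_) (∑-comm xs ys f)) (sym (∑-+ ys (f x) (λ y → ∑ xs (λ x′ → f x′ y))))

∑-allFin-suc : ∀ m (f : Fin (suc m) → ℕ) → ∑ (allFin (suc m)) f ≡ f zero + ∑ (allFin m) (f ∘ suc)
∑-allFin-suc m f = cong (f zero +_) (trans (cong (λ xs → ∑ xs f) (sym (map-tabulate id suc))) (∑-map suc (allFin m) f))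

∑-const : ∀ m c → ∑ (allFin m) (λ _ → c) ≡ m * c
∑-const zero    c = refl
∑-const (suc m) c = trans (∑-allFin-suc m _) (cong (c +_) (∑-const m c))

module _ {P : Pred A 0ℓ} (P? : Decidable P) where

  𝟙 : A → ℕ
  𝟙 x = if does (P? x) then 1 else 0

  𝟙-yes : ∀ x → P x → 𝟙 x ≡ 1
  𝟙-yes x px with P? x
  ... | yes _  = refl
  ... | no ¬px = ⊥-elim (¬px px)

  𝟙-no : ∀ x → ¬ P x → 𝟙 x ≡ 0
  𝟙-no x ¬px with P? x
  ... | yes px = ⊥-elim (¬px px)
  ... | no _   = refl

  length-filter≡∑𝟙 : ∀ xs → length (filter P? xs) ≡ ∑ xs 𝟙
  length-filter≡∑𝟙 []       = refl
  length-filter≡∑𝟙 (x ∷ xs) with does (P? x)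
  ... | true  = cong suc (length-filter≡∑𝟙 xs)
  ... | false = length-filter≡∑𝟙 xs

𝟙-cong : ∀ {P : Pred A 0ℓ} {Q : Pred B 0ℓ} (P? : Decidable P) (Q? : Decidable Q) x y →
  (P x → Q y) → (Q y → P x) → 𝟙 P? x ≡ 𝟙 Q? y
𝟙-cong P? Q? x y to from with P? x | Q? y
... | yes _  | yes _  = refl
... | no _   | no _   = refl
... | yes px | no ¬qy = ⊥-elim (¬qy (to px))
... | no ¬px | yes qy = ⊥-elim (¬px (from qy))

ListsOnce : {A : Set} → DecidableEquality A → List A → Set
ListsOnce _≟ᴬ_ xs = ∀ a → ∑ xs (𝟙 (_≟ᴬ a)) ≡ 1

allFin-once : ∀ m → ListsOnce _≟_ (allFin m)
allFin-once (suc m) zero    = trans (∑-allFin-suc m (𝟙 (_≟ zero)))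
  (cong suc (trans (∑-cong (allFin m) (λ x → 𝟙-no (_≟ zero) (suc x) λ ())) (∑-zero (allFin m))))
allFin-once (suc m) (suc a) = trans (∑-allFin-suc m (𝟙 (_≟ suc a))) (cong₂ _+_ (𝟙-no (_≟ suc a) zero λ ())
  (trans (∑-cong (allFin m) (λ x → 𝟙-cong (_≟ suc a) (_≟ a) (suc x) x suc-injective (cong suc))) (allFin-once m a)))

module _ {_≟ᴬ_ : DecidableEquality A} {_≟ᴮ_ : DecidableEquality B} where

  cartesianProduct-once : ∀ {xs ys} → ListsOnce _≟ᴬ_ xs → ListsOnce _≟ᴮ_ ys →
    ListsOnce (×-≡-dec _≟ᴬ_ _≟ᴮ_) (cartesianProduct xs ys)
  cartesianProduct-once {xs} {ys} xs-once ys-once (a , b) = begin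
    ∑ (cartesianProduct xs ys) (𝟙 (_≟² (a , b)))
      ≡⟨ ∑-cartesianProduct xs ys _ ⟩
    ∑ xs (λ x → ∑ ys (λ y → 𝟙 (_≟² (a , b)) (x , y)))
      ≡⟨ ∑-cong xs (λ x → ∑-cong ys (λ y → δ-pair x y (x ≟ᴬ a) (y ≟ᴮ b))) ⟩
    ∑ xs (λ x → ∑ ys (λ y → 𝟙 (_≟ᴬ a) x * 𝟙 (_≟ᴮ b) y))
      ≡⟨ ∑-cong xs (λ x → ∑-*ˡ ys (𝟙 (_≟ᴬ a) x) (𝟙 (_≟ᴮ b))) ⟩
    ∑ xs (λ x → 𝟙 (_≟ᴬ a) x * ∑ ys (𝟙 (_≟ᴮ b)))
      ≡⟨ ∑-cong xs (λ x → trans (cong (𝟙 (_≟ᴬ a) x *_) (ys-once b)) (*-identityʳ _)) ⟩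
    ∑ xs (𝟙 (_≟ᴬ a))
      ≡⟨ xs-once a ⟩
    1 ∎
    where
    open ≡-Reasoning
    _≟²_ : DecidableEquality (A × B)
    _≟²_ = ×-≡-dec _≟ᴬ_ _≟ᴮ_
    δ-pair : ∀ x y → Dec (x ≡ a) → Dec (y ≡ b) → 𝟙 (_≟² (a , b)) (x , y) ≡ 𝟙 (_≟ᴬ a) x * 𝟙 (_≟ᴮ b) y
    δ-pair x y (yes refl) (yes refl) =
      trans (𝟙-yes (_≟² (a , b)) _ refl) (sym (cong₂ _*_ (𝟙-yes (_≟ᴬ a) a refl) (𝟙-yes (_≟ᴮ b) b refl)))
    δ-pair x y (yes _) (no y≢b) =
      trans (𝟙-no (_≟² (a , b)) (x , y) (y≢b ∘ cong proj₂))
            (sym (trans (cong (𝟙 (_≟ᴬ a) x *_) (𝟙-no (_≟ᴮ b) y y≢b)) (*-zeroʳ (𝟙 (_≟ᴬ a) x))))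
    δ-pair x y (no x≢a) _ =
      trans (𝟙-no (_≟² (a , b)) (x , y) (x≢a ∘ cong proj₁)) (sym (cong (_* _) (𝟙-no (_≟ᴬ a) x x≢a)))

module _ {_≟ᴬ_ : DecidableEquality A} {xs : List A} (xs-once : ListsOnce _≟ᴬ_ xs) where

  ∑-sift : ∀ a (g : A → ℕ) → ∑ xs (λ x → 𝟙 (_≟ᴬ a) x * g x) ≡ g a
  ∑-sift a g = begin
    ∑ xs (λ x → 𝟙 (_≟ᴬ a) x * g x)  ≡⟨ ∑-cong xs (λ x → δ-comm x (x ≟ᴬ a)) ⟩
    ∑ xs (λ x → g a * 𝟙 (_≟ᴬ a) x)  ≡⟨ ∑-*ˡ xs (g a) _ ⟩
    g a * ∑ xs (𝟙 (_≟ᴬ a))          ≡⟨ cong (g a *_) (xs-once a) ⟩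
    g a * 1                         ≡⟨ *-identityʳ (g a) ⟩
    g a                             ∎
    where
    open ≡-Reasoning
    δ-comm : ∀ x → Dec (x ≡ a) → 𝟙 (_≟ᴬ a) x * g x ≡ g a * 𝟙 (_≟ᴬ a) x
    δ-comm x (yes refl) = *-comm _ (g x)
    δ-comm x (no x≢a)   = trans (cong (_* g x) (𝟙-no (_≟ᴬ a) x x≢a))
                                (sym (trans (cong (g a *_) (𝟙-no (_≟ᴬ a) x x≢a)) (*-zeroʳ (g a))))

  ∑-reindex : ∀ (ψ ψ⁻¹ : A → A) → (∀ x → ψ (ψ⁻¹ x) ≡ x) → (∀ x → ψ⁻¹ (ψ x) ≡ x) →
              ∀ (g : A → ℕ) → ∑ xs (g ∘ ψ) ≡ ∑ xs g
  ∑-reindex ψ ψ⁻¹ ψψ⁻¹ ψ⁻¹ψ g = begin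
    ∑ xs (g ∘ ψ)                                            ≡⟨ ∑-cong xs (λ x → ∑-sift (ψ x) g) ⟨
    ∑ xs (λ x → ∑ xs (λ y → 𝟙 (_≟ᴬ ψ x) y * g y))           ≡⟨ ∑-comm xs xs _ ⟩
    ∑ xs (λ y → ∑ xs (λ x → 𝟙 (_≟ᴬ ψ x) y * g y))           ≡⟨ ∑-cong xs (λ y → ∑-cong xs (λ x → cong (_* g y) (swap-δ x y))) ⟩
    ∑ xs (λ y → ∑ xs (λ x → 𝟙 (_≟ᴬ ψ⁻¹ y) x * g y))         ≡⟨ ∑-cong xs (λ y → ∑-sift (ψ⁻¹ y) (λ _ → g y)) ⟩
    ∑ xs g                                                  ∎
    where
    open ≡-Reasoning
    swap-δ : ∀ x y → 𝟙 (_≟ᴬ ψ x) y ≡ 𝟙 (_≟ᴬ ψ⁻¹ y) x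
    swap-δ x y = 𝟙-cong (_≟ᴬ ψ x) (_≟ᴬ ψ⁻¹ y) y x
      (λ y≡ψx → trans (sym (ψ⁻¹ψ x)) (cong ψ⁻¹ (sym y≡ψx)))
      (λ x≡ψ⁻¹y → trans (sym (ψψ⁻¹ y)) (cong ψ (sym x≡ψ⁻¹y)))

pairs : ∀ p → List (Dart p)
pairs p = cartesianProduct (allFin p) (allFin p)

∑-pairs-reindex : ∀ {p} (ψ ψ⁻¹ : Dart p → Dart p) → (∀ d → ψ (ψ⁻¹ d) ≡ d) → (∀ d → ψ⁻¹ (ψ d) ≡ d) →
                  ∀ (g : Dart p → ℕ) → ∑ (pairs p) (g ∘ ψ) ≡ ∑ (pairs p) g
∑-pairs-reindex {p} = ∑-reindex {_≟ᴬ_ = ×-≡-dec _≟_ _≟_} {pairs p}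
  (cartesianProduct-once {_≟ᴬ_ = _≟_} {_≟_} {allFin p} {allFin p} (allFin-once p) (allFin-once p))

-- Darts, edges and faces of a rotation system

Adj-sym : ∀ {p i u v} → Adj p i u v → Adj p i v u
Adj-sym (u≢v , ¬both) = (λ v≡u → u≢v (sym v≡u)) , (λ (v< , u<) → ¬both (u< , v<))

numDarts : ℕ → ℕ → ℕ
numDarts p i = length (filter (λ d → Adj? p i (proj₁ d) (proj₂ d)) (pairs p))

module _ (p i : ℕ) where
  private
    dart? : ∀ d → Dec (Adj p i (proj₁ d) (proj₂ d))
    dart? d = Adj? p i (proj₁ d) (proj₂ d)

    edge? : ∀ d → Dec (Adj p i (proj₁ d) (proj₂ d) × toℕ (proj₁ d) < toℕ (proj₂ d))
    edge? d = Adj? p i (proj₁ d) (proj₂ d) ×-dec (toℕ (proj₁ d) <? toℕ (proj₂ d))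

    swap : Dart p → Dart p
    swap (u , v) = v , u

    dart≡edge+reversed : ∀ d → 𝟙 dart? d ≡ 𝟙 edge? d + 𝟙 edge? (swap d)
    dart≡edge+reversed d@(u , v) with dart? d
    ... | no ¬adj = trans (𝟙-no dart? d ¬adj)
      (sym (cong₂ _+_ (𝟙-no edge? d (¬adj ∘ proj₁)) (𝟙-no edge? (v , u) (¬adj ∘ Adj-sym ∘ proj₁))))
    ... | yes adj with <-cmp (toℕ u) (toℕ v)
    ...   | tri< u<v _ v≮u = trans (𝟙-yes dart? d adj)
      (sym (cong₂ _+_ (𝟙-yes edge? d (adj , u<v)) (𝟙-no edge? (v , u) (v≮u ∘ proj₂))))
    ...   | tri≈ _ u≡v _   = ⊥-elim (proj₁ adj (toℕ-injective u≡v))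
    ...   | tri> u≮v _ v<u = trans (𝟙-yes dart? d adj)
      (sym (cong₂ _+_ (𝟙-no edge? d (u≮v ∘ proj₂)) (𝟙-yes edge? (v , u) (Adj-sym adj , v<u))))

  numDarts≡2*numEdges : numDarts p i ≡ 2 * numEdges p i
  numDarts≡2*numEdges = begin
    numDarts p i
      ≡⟨ length-filter≡∑𝟙 dart? (pairs p) ⟩
    ∑ (pairs p) (𝟙 dart?)
      ≡⟨ ∑-cong (pairs p) dart≡edge+reversed ⟩
    ∑ (pairs p) (λ d → 𝟙 edge? d + 𝟙 edge? (swap d))
      ≡⟨ ∑-+ (pairs p) _ _ ⟩
    ∑ (pairs p) (𝟙 edge?) + ∑ (pairs p) (𝟙 edge? ∘ swap)
      ≡⟨ cong (∑ (pairs p) (𝟙 edge?) +_) (∑-pairs-reindex swap swap (λ _ → refl) (λ _ → refl) (𝟙 edge?)) ⟩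
    ∑ (pairs p) (𝟙 edge?) + ∑ (pairs p) (𝟙 edge?)
      ≡⟨ cong (λ e → e + e) (length-filter≡∑𝟙 edge? (pairs p)) ⟨
    numEdges p i + numEdges p i
      ≡⟨ cong (numEdges p i +_) (+-identityʳ (numEdges p i)) ⟨
    2 * numEdges p i ∎
    where open ≡-Reasoning

module _ (a b c d : ℕ) where

  IsLeast₄ : ℕ → Set
  IsLeast₄ t = t ≤ a × t ≤ b × t ≤ c × t ≤ d

  isLeast₄? : ∀ t → Dec (IsLeast₄ t)
  isLeast₄? t = t ≤? a ×-dec t ≤? b ×-dec t ≤? c ×-dec t ≤? d

  private
    least : ℕ
    least = (a ⊓ b) ⊓ (c ⊓ d)

    least-isLeast : IsLeast₄ least
    least-isLeast = ≤-trans (m⊓n≤m _ _) (m⊓n≤m a b) , ≤-trans (m⊓n≤m _ _) (m⊓n≤n a b)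
                  , ≤-trans (m⊓n≤n _ _) (m⊓n≤m c d) , ≤-trans (m⊓n≤n _ _) (m⊓n≤n c d)

    least-sel : least ≡ a ⊎ least ≡ b ⊎ least ≡ c ⊎ least ≡ d
    least-sel with ⊓-sel (a ⊓ b) (c ⊓ d) | ⊓-sel a b | ⊓-sel c d
    ... | inj₁ l≡ab | inj₁ ab≡a | _         = inj₁ (trans l≡ab ab≡a)
    ... | inj₁ l≡ab | inj₂ ab≡b | _         = inj₂ (inj₁ (trans l≡ab ab≡b))
    ... | inj₂ l≡cd | _         | inj₁ cd≡c = inj₂ (inj₂ (inj₁ (trans l≡cd cd≡c)))
    ... | inj₂ l≡cd | _         | inj₂ cd≡d = inj₂ (inj₂ (inj₂ (trans l≡cd cd≡d)))

    δ : ℕ → ℕ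
    δ = 𝟙 (_≟ℕ least)

    isLeast≡δ : ∀ t → least ≤ t → 𝟙 isLeast₄? t ≡ δ t
    isLeast≡δ t least≤t = 𝟙-cong isLeast₄? (_≟ℕ least) t t
      (λ (t≤a , t≤b , t≤c , t≤d) → ≤-antisym (⊓-glb (⊓-glb t≤a t≤b) (⊓-glb t≤c t≤d)) least≤t)
      (λ { refl → least-isLeast })

  exactly-one-least₄ : a ≢ b → a ≢ c → a ≢ d → b ≢ c → b ≢ d → c ≢ d →
    𝟙 isLeast₄? a + 𝟙 isLeast₄? b + 𝟙 isLeast₄? c + 𝟙 isLeast₄? d ≡ 1
  exactly-one-least₄ a≢b a≢c a≢d b≢c b≢d c≢d = begin
    𝟙 isLeast₄? a + 𝟙 isLeast₄? b + 𝟙 isLeast₄? c + 𝟙 isLeast₄? d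
      ≡⟨ cong₂ _+_ (cong₂ _+_ (cong₂ _+_ (isLeast≡δ a l≤a) (isLeast≡δ b l≤b)) (isLeast≡δ c l≤c)) (isLeast≡δ d l≤d) ⟩
    δ a + δ b + δ c + δ d
      ≡⟨ sum least-sel ⟩
    1 ∎
    where
    open ≡-Reasoning
    l≤a : least ≤ a
    l≤a = proj₁ least-isLeast
    l≤b : least ≤ b
    l≤b = proj₁ (proj₂ least-isLeast)
    l≤c : least ≤ c
    l≤c = proj₁ (proj₂ (proj₂ least-isLeast))
    l≤d : least ≤ d
    l≤d = proj₂ (proj₂ (proj₂ least-isLeast))
    hit : ∀ {t} → least ≡ t → δ t ≡ 1
    hit l≡t = 𝟙-yes (_≟ℕ least) _ (sym l≡t)
    miss : ∀ {t u} → u ≢ t → least ≡ u → δ t ≡ 0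
    miss u≢t l≡u = 𝟙-no (_≟ℕ least) _ (λ t≡l → u≢t (sym (trans t≡l l≡u)))
    _&_&_&_ : ∀ {x y z w} → δ a ≡ x → δ b ≡ y → δ c ≡ z → δ d ≡ w → δ a + δ b + δ c + δ d ≡ x + y + z + w
    ea & eb & ec & ed = cong₂ _+_ (cong₂ _+_ (cong₂ _+_ ea eb) ec) ed
    sum : least ≡ a ⊎ least ≡ b ⊎ least ≡ c ⊎ least ≡ d → δ a + δ b + δ c + δ d ≡ 1
    sum (inj₁ l≡a)               = hit l≡a & miss a≢b l≡a & miss a≢c l≡a & miss a≢d l≡a
    sum (inj₂ (inj₁ l≡b))        = miss (a≢b ∘ sym) l≡b & hit l≡b & miss b≢c l≡b & miss b≢d l≡b
    sum (inj₂ (inj₂ (inj₁ l≡c))) = miss (a≢c ∘ sym) l≡c & miss (b≢c ∘ sym) l≡c & hit l≡c & miss c≢d l≡c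
    sum (inj₂ (inj₂ (inj₂ l≡d))) = miss (a≢d ∘ sym) l≡d & miss (b≢d ∘ sym) l≡d & miss (c≢d ∘ sym) l≡d & hit l≡d

code-injective : ∀ {p i} (R : RotationSystem p i) d d′ → code R d ≡ code R d′ → d ≡ d′
code-injective {p} R (u , v) (u′ , v′) eq = begin
  (u , v)                      ≡⟨ remQuot-combine u v ⟨
  remQuot p (combine u v)      ≡⟨ cong (remQuot p) (toℕ-injective (trans (sym (code≡ u v)) (trans eq (code≡ u′ v′)))) ⟩
  remQuot p (combine u′ v′)    ≡⟨ remQuot-combine u′ v′ ⟩
  (u′ , v′)                    ∎
  where
  open ≡-Reasoning
  code≡ : ∀ u v → code R (u , v) ≡ toℕ (combine u v)
  code≡ u v = trans (cong (_+ toℕ v) (*-comm (toℕ u) p)) (sym (toℕ-combine u v))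

module _ {p i : ℕ} (R : RotationSystem p i) where
  open RotationSystem R

  φ-dart : ∀ d → IsDart R d → IsDart R (φ R d)
  φ-dart (u , v) adj = rot-adj v u (Adj-sym adj)

  iter-φ-dart : ∀ k d → IsDart R d → IsDart R (iter (φ R) k d)
  iter-φ-dart zero    d dart = dart
  iter-φ-dart (suc k) d dart = φ-dart _ (iter-φ-dart k d dart)

module _ {p i : ℕ} (R : RotationSystem p i) (quad : Quadrangular R) (3≤p : 3 ≤ p) where
  private
    -- a permutation of all pairs, so that sums over pairs can be reindexed along it
    φ̂ : Dart p → Dart p
    φ̂ d with isDart? R d
    ... | yes _ = φ R d
    ... | no _  = d

    φ̂-dart : ∀ d → IsDart R d → φ̂ d ≡ φ R d
    φ̂-dart d dart with isDart? R d
    ... | yes _    = refl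
    ... | no ¬dart = ⊥-elim (¬dart dart)

    φ̂-nondart : ∀ d → ¬ IsDart R d → φ̂ d ≡ d
    φ̂-nondart d ¬dart with isDart? R d
    ... | yes dart = ⊥-elim (¬dart dart)
    ... | no _     = refl

    iter-φ̂-dart : ∀ k d → IsDart R d → iter φ̂ k d ≡ iter (φ R) k d
    iter-φ̂-dart zero    d dart = refl
    iter-φ̂-dart (suc k) d dart =
      trans (cong φ̂ (iter-φ̂-dart k d dart)) (φ̂-dart _ (iter-φ-dart R k d dart))

    iter-φ̂-nondart : ∀ k d → ¬ IsDart R d → iter φ̂ k d ≡ d
    iter-φ̂-nondart zero    d ¬dart = refl
    iter-φ̂-nondart (suc k) d ¬dart = trans (cong φ̂ (iter-φ̂-nondart k d ¬dart)) (φ̂-nondart d ¬dart)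

    φ̂⁴≡id : ∀ d → iter φ̂ 4 d ≡ d
    φ̂⁴≡id d = by-cases (isDart? R d)
      where
      by-cases : Dec (IsDart R d) → iter φ̂ 4 d ≡ d
      by-cases (yes dart) = trans (iter-φ̂-dart 4 d dart) (proj₁ (quad d dart))
      by-cases (no ¬dart) = iter-φ̂-nondart 4 d ¬dart

    ∑-φ̂ : ∀ j → j ≤ 4 → ∀ (g : Dart p → ℕ) → ∑ (pairs p) (g ∘ iter φ̂ j) ≡ ∑ (pairs p) g
    ∑-φ̂ j j≤4 = ∑-pairs-reindex (iter φ̂ j) (iter φ̂ (4 ∸ j)) (period j (4 ∸ j) (m+[n∸m]≡n j≤4)) (period (4 ∸ j) j (m∸n+n≡m j≤4))
      where
      period : ∀ a b → a + b ≡ 4 → ∀ d → iter φ̂ a (iter φ̂ b d) ≡ d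
      period a b a+b≡4 d = trans (sym (iter-+ φ̂ a b d)) (trans (cong (λ k → iter φ̂ k d) a+b≡4) (φ̂⁴≡id d))

  private
    module Face (d : Dart p) (dart : IsDart R d) where
      corner : ℕ → Dart p
      corner j = iter (φ R) j d

      label : ℕ → ℕ
      label j = code R (corner j)

      iter-corner : ∀ k j → iter (φ R) k (corner j) ≡ corner (k + j)
      iter-corner k j = sym (iter-+ (φ R) k j d)

      corner-mod4 : ∀ t → ∃[ m ] m < 4 × corner t ≡ corner m
      corner-mod4 zero = 0 , s≤s z≤n , refl
      corner-mod4 (suc t) with corner-mod4 t
      ... | 0 , _ , eq = 1 , s≤s (s≤s z≤n) , cong (φ R) eq
      ... | 1 , _ , eq = 2 , s≤s (s≤s (s≤s z≤n)) , cong (φ R) eq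
      ... | 2 , _ , eq = 3 , ≤-refl , cong (φ R) eq
      ... | 3 , _ , eq = 0 , s≤s z≤n , trans (cong (φ R) eq) (proj₁ (quad d dart))
      ... | suc (suc (suc (suc _))) , s≤s (s≤s (s≤s (s≤s ()))) , _

      Least : ℕ → Set
      Least = IsLeast₄ (label 0) (label 1) (label 2) (label 3)

      least-≤ : ∀ {t} m → m < 4 → Least t → t ≤ label m
      least-≤ 0 _ (t≤ , _ , _ , _) = t≤
      least-≤ 1 _ (_ , t≤ , _ , _) = t≤
      least-≤ 2 _ (_ , _ , t≤ , _) = t≤
      least-≤ 3 _ (_ , _ , _ , t≤) = t≤
      least-≤ (suc (suc (suc (suc _)))) (s≤s (s≤s (s≤s (s≤s ())))) _

      orbitMin→least : ∀ j → j ≤ 4 → OrbitMin R (corner j) → Least (label j)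
      orbitMin→least j j≤4 min = ≤label 0 (s≤s z≤n) , ≤label 1 (s≤s (s≤s z≤n))
                               , ≤label 2 (s≤s (s≤s (s≤s z≤n))) , ≤label 3 ≤-refl
        where
        ≤label : ∀ m → m < 4 → label j ≤ label m
        ≤label m m<4 = subst (label j ≤_) (cong (code R) back) (All.lookup min (∈-upTo⁺ k<p*p))
          where
          k : ℕ
          k = m + (4 ∸ j)
          k<p*p : k < p * p
          k<p*p = ≤-trans (s≤s (+-mono-≤ (≤-pred m<4) (m∸n≤m 4 j))) (≤-trans (n≤1+n 8) (*-mono-≤ 3≤p 3≤p))
          back : iter (φ R) k (corner j) ≡ corner m
          back = begin
            iter (φ R) k (corner j)        ≡⟨ iter-corner k j ⟩
            corner (m + (4 ∸ j) + j)       ≡⟨ cong corner (trans (+-assoc m (4 ∸ j) j) (cong (m +_) (m∸n+n≡m j≤4))) ⟩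
            corner (m + 4)                 ≡⟨ iter-+ (φ R) m 4 d ⟩
            iter (φ R) m (corner 4)        ≡⟨ cong (iter (φ R) m) (proj₁ (quad d dart)) ⟩
            corner m                       ∎
            where open ≡-Reasoning

      least→orbitMin : ∀ j → Least (label j) → OrbitMin R (corner j)
      least→orbitMin j least = All.tabulate λ {k} _ → ≤iter k
        where
        ≤iter : ∀ k → label j ≤ code R (iter (φ R) k (corner j))
        ≤iter k with m , m<4 , eq ← corner-mod4 (k + j) =
          subst (label j ≤_) (cong (code R) (sym (trans (iter-corner k j) eq))) (least-≤ m m<4 least)

      labels-distinct : ∀ a k → 0 < k → k < 4 → label a ≢ label (k + a)
      labels-distinct a k 0<k k<4 eq = proj₂ (quad (corner a) (iter-φ-dart R a d dart)) k 0<k k<4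
        (trans (iter-corner k a) (sym (code-injective R _ _ eq)))

    representative? : ∀ d → Dec (IsDart R d × OrbitMin R d)
    representative? d = isDart? R d ×-dec orbitMin? R d

    rep : Dart p → ℕ
    rep = 𝟙 representative?

    one-representative : ∀ d → IsDart R d →
      rep d + rep (iter (φ R) 1 d) + rep (iter (φ R) 2 d) + rep (iter (φ R) 3 d) ≡ 1
    one-representative d dart = begin
      rep (corner 0) + rep (corner 1) + rep (corner 2) + rep (corner 3)
        ≡⟨ cong₂ _+_ (cong₂ _+_ (cong₂ _+_ (rep≡least 0 z≤n) (rep≡least 1 (s≤s z≤n)))
                                (rep≡least 2 (s≤s (s≤s z≤n)))) (rep≡least 3 (s≤s (s≤s (s≤s z≤n)))) ⟩
      𝟙 least? (label 0) + 𝟙 least? (label 1) + 𝟙 least? (label 2) + 𝟙 least? (label 3)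
        ≡⟨ exactly-one-least₄ _ _ _ _
             (labels-distinct 0 1 z<s 1<4) (labels-distinct 0 2 z<s 2<4) (labels-distinct 0 3 z<s 3<4)
             (labels-distinct 1 1 z<s 1<4) (labels-distinct 1 2 z<s 2<4) (labels-distinct 2 1 z<s 1<4) ⟩
      1 ∎
      where
      open ≡-Reasoning
      open Face d dart
      1<4 : 1 < 4
      1<4 = s<s z<s
      2<4 : 2 < 4
      2<4 = s<s (s<s z<s)
      3<4 : 3 < 4
      3<4 = s<s (s<s (s<s z<s))
      least? : ∀ t → Dec (Least t)
      least? = isLeast₄? (label 0) (label 1) (label 2) (label 3)
      rep≡least : ∀ j → j ≤ 4 → rep (corner j) ≡ 𝟙 least? (label j)
      rep≡least j j≤4 = 𝟙-cong representative? least? (corner j) (label j)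
        (λ (_ , min) → orbitMin→least j j≤4 min)
        (λ least → iter-φ-dart R j d dart , least→orbitMin j least)

    reps : Dart p → ℕ
    reps d = rep d + rep (iter φ̂ 1 d) + rep (iter φ̂ 2 d) + rep (iter φ̂ 3 d)

    dart≡reps : ∀ d → 𝟙 (isDart? R) d ≡ reps d
    dart≡reps d = by-cases (isDart? R d)
      where
      by-cases : Dec (IsDart R d) → 𝟙 (isDart? R) d ≡ reps d
      by-cases (yes dart) = begin
        𝟙 (isDart? R) d  ≡⟨ 𝟙-yes (isDart? R) d dart ⟩
        1                ≡⟨ one-representative d dart ⟨
        rep d + rep (iter (φ R) 1 d) + rep (iter (φ R) 2 d) + rep (iter (φ R) 3 d)
          ≡⟨ cong₂ _+_ (cong₂ _+_ (cong (rep d +_) (along 1)) (along 2)) (along 3) ⟨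
        reps d           ∎
        where
        open ≡-Reasoning
        along : ∀ k → rep (iter φ̂ k d) ≡ rep (iter (φ R) k d)
        along k = cong rep (iter-φ̂-dart k d dart)
      by-cases (no ¬dart) = trans (𝟙-no (isDart? R) d ¬dart) (sym
        (cong₂ _+_ (cong₂ _+_ (cong₂ _+_ (no-rep 0) (no-rep 1)) (no-rep 2)) (no-rep 3)))
        where
        no-rep : ∀ k → rep (iter φ̂ k d) ≡ 0
        no-rep k = trans (cong rep (iter-φ̂-nondart k d ¬dart)) (𝟙-no representative? d (¬dart ∘ proj₁))

  numDarts≡4*numFaces : numDarts p i ≡ 4 * numFaces R
  numDarts≡4*numFaces = begin
    numDarts p i
      ≡⟨ length-filter≡∑𝟙 (isDart? R) (pairs p) ⟩
    ∑ (pairs p) (𝟙 (isDart? R))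
      ≡⟨ ∑-cong (pairs p) dart≡reps ⟩
    ∑ (pairs p) reps
      ≡⟨ trans (∑-+ (pairs p) _ (rep ∘ iter φ̂ 3)) (cong (_+ ∑ (pairs p) (rep ∘ iter φ̂ 3))
           (trans (∑-+ (pairs p) _ (rep ∘ iter φ̂ 2)) (cong (_+ ∑ (pairs p) (rep ∘ iter φ̂ 2)) (∑-+ (pairs p) rep (rep ∘ iter φ̂ 1))))) ⟩
    ∑ (pairs p) rep + ∑ (pairs p) (rep ∘ iter φ̂ 1) + ∑ (pairs p) (rep ∘ iter φ̂ 2) + ∑ (pairs p) (rep ∘ iter φ̂ 3)
      ≡⟨ cong₂ _+_ (cong₂ _+_ (cong (∑ (pairs p) rep +_) (∑-φ̂ 1 (s≤s z≤n) rep)) (∑-φ̂ 2 (s≤s (s≤s z≤n)) rep))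
                   (∑-φ̂ 3 (s≤s (s≤s (s≤s z≤n))) rep) ⟩
    ∑ (pairs p) rep + ∑ (pairs p) rep + ∑ (pairs p) rep + ∑ (pairs p) rep
      ≡⟨ four-times (∑ (pairs p) rep) ⟩
    4 * ∑ (pairs p) rep
      ≡⟨ cong (4 *_) (length-filter≡∑𝟙 representative? (pairs p)) ⟨
    4 * numFaces R ∎
    where
    open ≡-Reasoning
    four-times : ∀ a → a + a + a + a ≡ 4 * a
    four-times = solve-∀

module _ (m : ℕ) where
  private
    p : ℕ
    p = 4 + m

    adj? : ∀ d → Dec (Adj p 4 (proj₁ d) (proj₂ d))
    adj? d = Adj? p 4 (proj₁ d) (proj₂ d)

    shift4 : Fin m → Fin p
    shift4 w = suc (suc (suc (suc w)))

    ∑-allFin-4+ : ∀ (f : Fin p → ℕ) →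
      ∑ (allFin p) f ≡ f zero + (f (suc zero) + (f (suc (suc zero)) + (f (suc (suc (suc zero))) + ∑ (allFin m) (f ∘ shift4))))
    ∑-allFin-4+ f =
      trans (∑-allFin-suc (3 + m) f) (cong (f zero +_)
      (trans (∑-allFin-suc (2 + m) (λ i → f (suc i))) (cong (f (suc zero) +_)
      (trans (∑-allFin-suc (1 + m) (λ i → f (suc (suc i)))) (cong (f (suc (suc zero)) +_)
      (∑-allFin-suc m (λ i → f (suc (suc (suc i))))))))))

    row : Fin p → ℕ
    row u = ∑ (allFin p) (λ v → 𝟙 adj? (u , v))

    ones : ∑ (allFin m) (λ _ → 1) ≡ m
    ones = trans (∑-const m 1) (*-identityʳ m)

    row-deleted : ∀ u → toℕ u < 4 → row u ≡ m
    row-deleted zero                      _ = trans (∑-allFin-4+ (λ v → 𝟙 adj? (zero , v))) ones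
    row-deleted (suc zero)                _ = trans (∑-allFin-4+ (λ v → 𝟙 adj? (suc zero , v))) ones
    row-deleted (suc (suc zero))          _ = trans (∑-allFin-4+ (λ v → 𝟙 adj? (suc (suc zero) , v))) ones
    row-deleted (suc (suc (suc zero)))    _ = trans (∑-allFin-4+ (λ v → 𝟙 adj? (suc (suc (suc zero)) , v))) ones
    row-deleted (suc (suc (suc (suc _)))) (s≤s (s≤s (s≤s (s≤s ()))))

    shift4-injective : ∀ {w w′} → shift4 w ≡ shift4 w′ → w ≡ w′
    shift4-injective = suc-injective ∘ suc-injective ∘ suc-injective ∘ suc-injective

    adjacent-or-equal : ∀ w w′ → 𝟙 adj? (shift4 w , shift4 w′) + 𝟙 (_≟ w) w′ ≡ 1
    adjacent-or-equal w w′ with w′ ≟ w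
    ... | yes refl = cong (_+ 1) (𝟙-no adj? (shift4 w , shift4 w) (λ adj → proj₁ adj refl))
    ... | no w′≢w  = cong (_+ 0) (𝟙-yes adj? (shift4 w , shift4 w′)
                      ((λ eq → w′≢w (sym (shift4-injective eq))) , λ { (s≤s (s≤s (s≤s (s≤s ()))) , _) }))

    other-ordinary : ∀ w → ∑ (allFin m) (λ w′ → 𝟙 adj? (shift4 w , shift4 w′)) + 1 ≡ m
    other-ordinary w = begin
      adjacent + 1                                                     ≡⟨ cong (adjacent +_) (allFin-once m w) ⟨
      adjacent + ∑ (allFin m) (𝟙 (_≟ w))                               ≡⟨ ∑-+ (allFin m) _ _ ⟨
      ∑ (allFin m) (λ w′ → 𝟙 adj? (shift4 w , shift4 w′) + 𝟙 (_≟ w) w′) ≡⟨ ∑-cong (allFin m) (adjacent-or-equal w) ⟩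
      ∑ (allFin m) (λ _ → 1)                                           ≡⟨ ones ⟩
      m                                                                ∎
      where
      open ≡-Reasoning
      adjacent : ℕ
      adjacent = ∑ (allFin m) (λ w′ → 𝟙 adj? (shift4 w , shift4 w′))

    row-kept : ∀ w → row (shift4 w) + 1 ≡ m + 4
    row-kept w = begin
      row (shift4 w) + 1                                           ≡⟨ cong (_+ 1) (∑-allFin-4+ (λ v → 𝟙 adj? (shift4 w , v))) ⟩
      4 + ∑ (allFin m) (λ w′ → 𝟙 adj? (shift4 w , shift4 w′)) + 1  ≡⟨ +-assoc 4 _ 1 ⟩
      4 + (∑ (allFin m) (λ w′ → 𝟙 adj? (shift4 w , shift4 w′)) + 1) ≡⟨ cong (4 +_) (other-ordinary w) ⟩
      4 + m                                                        ≡⟨ +-comm 4 m ⟩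
      m + 4                                                        ∎
      where open ≡-Reasoning

  numDarts-K-K₄ : numDarts (4 + m) 4 ≡ m * (m + 7)
  numDarts-K-K₄ = begin
    numDarts p 4                       ≡⟨ length-filter≡∑𝟙 adj? (pairs p) ⟩
    ∑ (pairs p) (𝟙 adj?)               ≡⟨ ∑-cartesianProduct (allFin p) (allFin p) (𝟙 adj?) ⟩
    ∑ (allFin p) row                   ≡⟨ ∑-allFin-4+ row ⟩
    row zero + (row (suc zero) + (row (suc (suc zero)) + (row (suc (suc (suc zero))) + ∑ (allFin m) (row ∘ shift4))))
      ≡⟨ cong₂ _+_ (row-deleted zero z<s) (cong₂ _+_ (row-deleted (suc zero) (s<s z<s))
           (cong₂ _+_ (row-deleted (suc (suc zero)) (s<s (s<s z<s)))
             (cong₂ _+_ (row-deleted (suc (suc (suc zero))) (s<s (s<s (s<s z<s))))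
               (trans (∑-cong (allFin m) (λ w → +-cancelʳ-≡ 1 _ _ (trans (row-kept w) (sym (+-assoc m 3 1))))) (∑-const m (m + 3)))))) ⟩
    m + (m + (m + (m + m * (m + 3))))  ≡⟨ count m ⟩
    m * (m + 7)                        ∎
    where
    open ≡-Reasoning
    count : ∀ m → m + (m + (m + (m + m * (m + 3)))) ≡ m * (m + 7)
    count = solve-∀

genus-of-quadrangular : ∀ {p i} (R : RotationSystem p i) → Quadrangular R → 3 ≤ p → ∀ h →
  4 * p + 8 * h ≡ numDarts p i + 8 → EmbeddedInGenus R h
genus-of-quadrangular {p} {i} R quad 3≤p h euler = *-cancelˡ-≡ _ _ 4 (begin
  4 * (p + F + 2 * h)   ≡⟨ expand p F h ⟩
  4 * p + 8 * h + 4 * F ≡⟨ cong₂ _+_ euler (sym (numDarts≡4*numFaces R quad 3≤p)) ⟩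
  D + 8 + D             ≡⟨ cong (λ d → d + 8 + d) (numDarts≡2*numEdges p i) ⟩
  2 * E + 8 + 2 * E     ≡⟨ collect E ⟩
  4 * (E + 2)           ∎)
  where
  open ≡-Reasoning
  F E D : ℕ
  F = numFaces R
  E = numEdges p i
  D = numDarts p i
  expand : ∀ p F h → 4 * (p + F + 2 * h) ≡ 4 * p + 8 * h + 4 * F
  expand = solve-∀
  collect : ∀ E → 2 * E + 8 + 2 * E ≡ 4 * (E + 2)
  collect = solve-∀

-- Derived embeddings

module QuadrangularLift {p i : ℕ} (R : RotationSystem p i) {W T : Set}
  (lift : W → T → Dart p) (move : T → W → W) (next : T → T) (Good : T → Set)
  (next-good : ∀ t → Good t → Good (next t))
  (φ-lift : ∀ w t → Good t → φ R (lift w t) ≡ lift (move t w) (next t))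
  (lift-injective : ∀ {w w′ t t′} → Good t → Good t′ → lift w t ≡ lift w′ t′ → t ≡ t′)
  (lift-onto : ∀ d → IsDart R d → ∃[ w ] ∃[ t ] Good t × lift w t ≡ d)
  where

  walk : ℕ → T → W → W
  walk zero    t w = w
  walk (suc k) t w = walk k (next t) (move t w)

  iter-good : ∀ k t → Good t → Good (iter next k t)
  iter-good zero    t good = good
  iter-good (suc k) t good = next-good _ (iter-good k t good)

  iter-φ-lift : ∀ k w t → Good t → iter (φ R) k (lift w t) ≡ lift (walk k t w) (iter next k t)
  iter-φ-lift zero    w t good = refl
  iter-φ-lift (suc k) w t good = begin
    iter (φ R) (suc k) (lift w t)             ≡⟨ iter-sucʳ (φ R) k (lift w t) ⟩
    iter (φ R) k (φ R (lift w t))             ≡⟨ cong (iter (φ R) k) (φ-lift w t good) ⟩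
    iter (φ R) k (lift (move t w) (next t))   ≡⟨ iter-φ-lift k (move t w) (next t) (next-good t good) ⟩
    lift (walk k (next t) (move t w)) (iter next k (next t)) ≡⟨ cong (lift _) (iter-sucʳ next k t) ⟨
    lift (walk (suc k) t w) (iter next (suc k) t) ∎
    where open ≡-Reasoning

  FaceOfLength4 : T → Set
  FaceOfLength4 t = iter next 4 t ≡ t × (∀ k → 0 < k → k < 4 → iter next k t ≢ t) × (∀ w → walk 4 t w ≡ w)

  quadrangular : (∀ t → Good t → FaceOfLength4 t) → Quadrangular R
  quadrangular face d dart with w , t , good , refl ← lift-onto d dart
                           with next⁴ , exact , walk⁴ ← face t good =
    trans (iter-φ-lift 4 w t good) (cong₂ lift (walk⁴ w) next⁴) ,
    λ k 0<k k<4 eq → exact k 0<k k<4 (lift-injective (iter-good k t good) good (trans (sym (iter-φ-lift k w t good)) eq))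

-- Translations of ℤₙ

module Translation (n : ℕ) .{{_ : NonZero n}} where

  infixl 6 _⊕_
  _⊕_ : Fin n → ℕ → Fin n
  w ⊕ a = (toℕ w + a) mod n

  _⊖_ : Fin n → Fin n → ℕ
  w′ ⊖ w = (toℕ w′ + (n ∸ toℕ w)) % n

  toℕ-⊕ : ∀ w a → toℕ (w ⊕ a) ≡ (toℕ w + a) % n
  toℕ-⊕ w a = toℕ-fromℕ< (m%n<n (toℕ w + a) n)

  %-absorbˡ : ∀ a b → (a % n + b) % n ≡ (a + b) % n
  %-absorbˡ a b = begin
    (a % n + b) % n          ≡⟨ %-distribˡ-+ (a % n) b n ⟩
    (a % n % n + b % n) % n  ≡⟨ cong (λ x → (x + b % n) % n) (m%n%n≡m%n a n) ⟩
    (a % n + b % n) % n      ≡⟨ %-distribˡ-+ a b n ⟨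
    (a + b) % n              ∎
    where open ≡-Reasoning

  toℕ-%-self : ∀ (w : Fin n) → toℕ w % n ≡ toℕ w
  toℕ-%-self w = m<n⇒m%n≡m (toℕ<n w)

  ⊕-⊕ : ∀ w a b → w ⊕ a ⊕ b ≡ w ⊕ (a + b)
  ⊕-⊕ w a b = toℕ-injective (begin
    toℕ (w ⊕ a ⊕ b)             ≡⟨ toℕ-⊕ (w ⊕ a) b ⟩
    (toℕ (w ⊕ a) + b) % n       ≡⟨ cong (λ x → (x + b) % n) (toℕ-⊕ w a) ⟩
    ((toℕ w + a) % n + b) % n   ≡⟨ %-absorbˡ (toℕ w + a) b ⟩
    (toℕ w + a + b) % n         ≡⟨ cong (_% n) (+-assoc (toℕ w) a b) ⟩
    (toℕ w + (a + b)) % n       ≡⟨ toℕ-⊕ w (a + b) ⟨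
    toℕ (w ⊕ (a + b))           ∎)
    where open ≡-Reasoning

  ⊕-multiple : ∀ w k → w ⊕ k * n ≡ w
  ⊕-multiple w k = toℕ-injective (trans (toℕ-⊕ w (k * n))
    (trans ([m+kn]%n≡m%n (toℕ w) k n) (toℕ-%-self w)))

  ⊕-identityʳ : ∀ w → w ⊕ 0 ≡ w
  ⊕-identityʳ w = ⊕-multiple w 0

  ⊕-cancel : ∀ w {a} → a ≤ n → w ⊕ a ⊕ (n ∸ a) ≡ w
  ⊕-cancel w {a} a≤n = begin
    w ⊕ a ⊕ (n ∸ a)    ≡⟨ ⊕-⊕ w a (n ∸ a) ⟩
    w ⊕ (a + (n ∸ a))  ≡⟨ cong (w ⊕_) (trans (m+[n∸m]≡n a≤n) (sym (*-identityˡ n))) ⟩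
    w ⊕ 1 * n          ≡⟨ ⊕-multiple w 1 ⟩
    w                  ∎
    where open ≡-Reasoning

  ⊖-< : ∀ w′ w → w′ ⊖ w < n
  ⊖-< w′ w = m%n<n (toℕ w′ + (n ∸ toℕ w)) n

  ⊕-⊖ : ∀ w w′ → w ⊕ (w′ ⊖ w) ≡ w′
  ⊕-⊖ w w′ = toℕ-injective (begin
    toℕ (w ⊕ (w′ ⊖ w))                      ≡⟨ toℕ-⊕ w (w′ ⊖ w) ⟩
    (toℕ w + (w′ ⊖ w)) % n                  ≡⟨ cong (_% n) (+-comm (toℕ w) (w′ ⊖ w)) ⟩
    ((toℕ w′ + (n ∸ toℕ w)) % n + toℕ w) % n ≡⟨ %-absorbˡ (toℕ w′ + (n ∸ toℕ w)) (toℕ w) ⟩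
    (toℕ w′ + (n ∸ toℕ w) + toℕ w) % n      ≡⟨ cong (_% n) (trans (+-assoc (toℕ w′) _ _) (cong (toℕ w′ +_) (m∸n+n≡m (<⇒≤ (toℕ<n w))))) ⟩
    (toℕ w′ + n) % n                        ≡⟨ [m+n]%n≡m%n (toℕ w′) n ⟩
    toℕ w′ % n                              ≡⟨ toℕ-%-self w′ ⟩
    toℕ w′                                  ∎)
    where open ≡-Reasoning

  ⊕-⊖-cancel : ∀ w {a} → a < n → (w ⊕ a) ⊖ w ≡ a
  ⊕-⊖-cancel w {a} a<n = begin
    (toℕ (w ⊕ a) + (n ∸ toℕ w)) % n           ≡⟨ cong (λ x → (x + (n ∸ toℕ w)) % n) (toℕ-⊕ w a) ⟩
    ((toℕ w + a) % n + (n ∸ toℕ w)) % n       ≡⟨ %-absorbˡ (toℕ w + a) (n ∸ toℕ w) ⟩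
    (toℕ w + a + (n ∸ toℕ w)) % n             ≡⟨ cong (_% n) (rearrange (toℕ w) a (n ∸ toℕ w)) ⟩
    (a + (toℕ w + (n ∸ toℕ w))) % n           ≡⟨ cong (λ x → (a + x) % n) (m+[n∸m]≡n (<⇒≤ (toℕ<n w))) ⟩
    (a + n) % n                               ≡⟨ [m+n]%n≡m%n a n ⟩
    a % n                                     ≡⟨ m<n⇒m%n≡m a<n ⟩
    a                                         ∎
    where
    open ≡-Reasoning
    rearrange : ∀ x y z → x + y + z ≡ y + (x + z)
    rearrange x y z = trans (cong (_+ z) (+-comm x y)) (+-assoc y x z)

  ⊖-self : ∀ w → w ⊖ w ≡ 0
  ⊖-self w = trans (cong (_% n) (m+[n∸m]≡n (<⇒≤ (toℕ<n w)))) (n%n≡0 n)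

  iter-⊕1 : ∀ k w → iter (_⊕ 1) k w ≡ w ⊕ k
  iter-⊕1 zero    w = sym (⊕-identityʳ w)
  iter-⊕1 (suc k) w = trans (cong (_⊕ 1) (iter-⊕1 k w)) (trans (⊕-⊕ w k 1) (cong (w ⊕_) (+-comm k 1)))

  ⊕1-connected : ∀ w w′ → ∃[ k ] iter (_⊕ 1) k w ≡ w′
  ⊕1-connected w w′ = w′ ⊖ w , trans (iter-⊕1 (w′ ⊖ w) w) (⊕-⊖ w w′)

  private
    1≤n : 1 ≤ n
    1≤n = >-nonZero⁻¹ n

    ⊕-injective : ∀ {a b} → (∀ w → w ⊕ a ⊕ b ≡ w) → ∀ w w′ → w ⊕ a ≡ w′ ⊕ a → w ≡ w′
    ⊕-injective {a} {b} inverse w w′ eq = trans (sym (inverse w)) (trans (cong (_⊕ b) eq) (inverse w′))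

    ⊕-1-⊕1 : ∀ w → w ⊕ (n ∸ 1) ⊕ 1 ≡ w
    ⊕-1-⊕1 w = trans (⊕-⊕ w (n ∸ 1) 1) (trans (cong (w ⊕_) (trans (m∸n+n≡m 1≤n) (sym (*-identityˡ n)))) (⊕-multiple w 1))

  ⊕1-cyclic : CyclicOn (λ _ → ⊤) (_⊕ 1)
  ⊕1-cyclic = record
    { closed    = λ _ _ → tt
    ; injective = λ w w′ _ _ → ⊕-injective (λ w → ⊕-cancel w 1≤n) w w′
    ; connected = λ w w′ _ _ → ⊕1-connected w w′
    }

  ⊕-1-cyclic : CyclicOn (λ _ → ⊤) (_⊕ (n ∸ 1))
  ⊕-1-cyclic = record
    { closed    = λ _ _ → tt
    ; injective = λ w w′ _ _ → ⊕-injective ⊕-1-⊕1 w w′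
    ; connected = λ w w′ _ _ → reach-inverse (λ w → ⊕-cancel w 1≤n) (⊕1-connected w′ w)
    }

-- The current graph

data Ordering⁺ : Set where
  less equal succ greater : Ordering⁺

compare⁺ : ℕ → ℕ → Ordering⁺
compare⁺ zero    (suc _) = less
compare⁺ (suc q) (suc N) = compare⁺ q N
compare⁺ q       zero    = against-zero q
  where
  against-zero : ℕ → Ordering⁺
  against-zero zero          = equal
  against-zero (suc zero)    = succ
  against-zero (suc (suc _)) = greater

compare⁺-< : ∀ {q N} → q < N → compare⁺ q N ≡ less
compare⁺-< {zero}  {suc N} _         = refl
compare⁺-< {suc q} {suc N} (s≤s q<N) = compare⁺-< q<N

compare⁺-≡ : ∀ N → compare⁺ N N ≡ equal
compare⁺-≡ zero    = refl
compare⁺-≡ (suc N) = compare⁺-≡ N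

compare⁺-suc : ∀ N → compare⁺ (suc N) N ≡ succ
compare⁺-suc zero    = refl
compare⁺-suc (suc N) = compare⁺-suc N

data Upto (q N : ℕ) : Set where
  below : q < N → Upto q N
  at    : q ≡ N → Upto q N
  above : q ≡ suc N → Upto q N

upto : ∀ {q N} → q ≤ suc N → Upto q N
upto {zero}          {zero}  _ = at refl
upto {zero}          {suc N} _ = below z<s
upto {suc zero}      {zero}  _ = above refl
upto {suc (suc q)}   {zero}  (s≤s ())
upto {suc q}         {suc N} (s≤s q≤1+N) with upto q≤1+N
... | below q<N   = below (s<s q<N)
... | at refl     = at refl
... | above refl  = above refl

data Residue : Set where
  r0 r1 r2 r3 : Residue

data Vortex : Set where
  va vb vc vd : Vortex

-- pos r q and neg r q are the currents +(4q + r) and −(4q + r); vor x stands for the edge to vortex x.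
data Current : Set where
  pos neg : Residue → ℕ → Current
  vor     : Vortex → Current

⟦_⟧ : Residue → ℕ
⟦ r0 ⟧ = 0
⟦ r1 ⟧ = 1
⟦ r2 ⟧ = 2
⟦ r3 ⟧ = 3

magnitude : Residue → ℕ → ℕ
magnitude r q = q * 4 + ⟦ r ⟧

divMod4 : ℕ → Residue × ℕ
divMod4 0 = r0 , 0
divMod4 1 = r1 , 0
divMod4 2 = r2 , 0
divMod4 3 = r3 , 0
divMod4 (suc (suc (suc (suc a)))) with r , q ← divMod4 a = r , suc q

magnitude-divMod4 : ∀ a → uncurry magnitude (divMod4 a) ≡ a
magnitude-divMod4 0 = refl
magnitude-divMod4 1 = refl
magnitude-divMod4 2 = refl
magnitude-divMod4 3 = refl
magnitude-divMod4 (suc (suc (suc (suc a)))) = cong (4 +_) (magnitude-divMod4 a)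

divMod4-magnitude : ∀ r q → divMod4 (magnitude r q) ≡ (r , q)
divMod4-magnitude r0 zero    = refl
divMod4-magnitude r1 zero    = refl
divMod4-magnitude r2 zero    = refl
divMod4-magnitude r3 zero    = refl
divMod4-magnitude r  (suc q) rewrite divMod4-magnitude r q = refl

reverse : Current → Current
reverse (pos r q) = neg r q
reverse (neg r q) = pos r q
reverse (vor x)   = vor x

data BaseDart : Set where
  along : Current → BaseDart
  out   : Vortex → BaseDart

-- The dart into vortex x is followed by the step w ↦ w ± 1 at x, so it counts as a current ±1.
plusPart minusPart : BaseDart → ℕ
plusPart (along (pos r q)) = magnitude r q
plusPart (along (vor va))  = 1
plusPart (along (vor vb))  = 1
plusPart _                 = 0
minusPart (along (neg r q)) = magnitude r q
minusPart (along (vor vc))  = 1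
minusPart (along (vor vd))  = 1
minusPart _                 = 0

module CurrentGraph (N : ℕ) where

  InRange : Residue → ℕ → Set
  InRange r0 q = 1 ≤ q × q ≤ suc N
  InRange r1 q = q ≤ suc N
  InRange r2 q = q ≤ suc N
  InRange r3 q = q ≤ N

  Valid : Current → Set
  Valid (pos r q) = InRange r q
  Valid (neg r q) = InRange r q
  Valid (vor _)   = ⊤

  M : ℕ
  M = N * 4 + 6

  private
    ≤M-of-≤1+N : ∀ {q r} → q ≤ suc N → r ≤ 2 → q * 4 + r ≤ M
    ≤M-of-≤1+N q≤1+N r≤2 = ≤-trans (+-mono-≤ (*-monoˡ-≤ 4 q≤1+N) r≤2) (≤-reflexive (lemma N))
      where lemma : ∀ N → suc N * 4 + 2 ≡ N * 4 + 6
            lemma = solve-∀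

    ≤1+N-of-≤M : ∀ {q r} → q * 4 + r ≤ M → q ≤ suc N
    ≤1+N-of-≤M {q} {r} ≤M = ≤-pred (*-cancelʳ-< 4 q (2 + N)
      (≤-<-trans (≤-trans (m≤m+n (q * 4) r) ≤M) (subst (M <_) (lemma N) (m<m+n M {2} z<s))))
      where lemma : ∀ N → N * 4 + 6 + 2 ≡ (2 + N) * 4
            lemma = solve-∀

    ≤N-of-≤M : ∀ {q} → q * 4 + 3 ≤ M → q ≤ N
    ≤N-of-≤M {q} ≤M = ≤-pred (*-cancelʳ-< 4 q (1 + N)
      (subst (q * 4 <_) (lemma₂ N) (s≤s (+-cancelʳ-≤ 3 (q * 4) (N * 4 + 3) (subst (q * 4 + 3 ≤_) (lemma₁ N) ≤M)))))
      where lemma₁ : ∀ N → N * 4 + 6 ≡ N * 4 + 3 + 3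
            lemma₁ = solve-∀
            lemma₂ : ∀ N → suc (N * 4 + 3) ≡ (1 + N) * 4
            lemma₂ = solve-∀

  magnitude-bounds : ∀ r q → InRange r q → 1 ≤ magnitude r q × magnitude r q ≤ M
  magnitude-bounds r0 (suc q) (_ , q<1+N) = z<s , ≤M-of-≤1+N q<1+N z≤n
  magnitude-bounds r1 q q≤1+N = m≤n+m 1 (q * 4) , ≤M-of-≤1+N q≤1+N (s≤s z≤n)
  magnitude-bounds r2 q q≤1+N = ≤-trans (s≤s z≤n) (m≤n+m 2 (q * 4)) , ≤M-of-≤1+N q≤1+N (s≤s (s≤s z≤n))
  magnitude-bounds r3 q q≤N   = ≤-trans (s≤s z≤n) (m≤n+m 3 (q * 4)) , +-mono-≤ (*-monoˡ-≤ 4 q≤N) (s≤s (s≤s (s≤s z≤n)))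

  inRange : ∀ r q → 1 ≤ magnitude r q → magnitude r q ≤ M → InRange r q
  inRange r0 zero    () _
  inRange r0 (suc q) _  ≤M = z<s , ≤1+N-of-≤M ≤M
  inRange r1 q       _  ≤M = ≤1+N-of-≤M ≤M
  inRange r2 q       _  ≤M = ≤1+N-of-≤M ≤M
  inRange r3 q       _  ≤M = ≤N-of-≤M ≤M

  -- Currents outside the valid range are sent to vor va; those clauses are junk.
  σ : Current → Current
  σ (vor va) = neg r2 N
  σ (vor vb) = pos r2 N
  σ (vor vc) = pos r1 (suc N)
  σ (vor vd) = pos r2 (suc N)
  σ (pos r0 zero) = vor va
  σ (pos r0 (suc q)) with compare⁺ q N
  ... | less  = pos r3 (suc q)
  ... | equal = vor vc
  ... | _     = vor va
  σ (pos r1 zero) = pos r0 (suc N)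
  σ (pos r1 (suc q)) with compare⁺ q N
  ... | less  = neg r0 (suc q)
  ... | equal = vor vd
  ... | _     = vor va
  σ (pos r2 q) with compare⁺ q N
  ... | less    = neg r3 q
  ... | equal   = pos r1 N
  ... | succ    = neg r1 0
  ... | greater = vor va
  σ (pos r3 q) with compare⁺ q N
  ... | less  = pos r1 q
  ... | equal = vor vb
  ... | _     = vor va
  σ (neg r0 zero) = vor va
  σ (neg r0 (suc q)) with compare⁺ q N
  ... | less  = neg r2 q
  ... | equal = pos r3 0
  ... | _     = vor va
  σ (neg r1 q) with compare⁺ q N
  ... | less    = pos r0 (suc q)
  ... | equal   = vor va
  ... | succ    = neg r0 (suc N)
  ... | greater = vor va
  σ (neg r2 q) with compare⁺ q N
  ... | less    = neg r1 (suc q)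
  ... | equal   = neg r3 N
  ... | succ    = neg r1 (suc N)
  ... | greater = vor va
  σ (neg r3 zero) = neg r2 (suc N)
  σ (neg r3 (suc q)) with compare⁺ q N
  ... | less = pos r2 q
  ... | _    = vor va

  σ⁻¹ : Current → Current
  σ⁻¹ (vor va) = neg r1 N
  σ⁻¹ (vor vb) = pos r3 N
  σ⁻¹ (vor vc) = pos r0 (suc N)
  σ⁻¹ (vor vd) = pos r1 (suc N)
  σ⁻¹ (pos r0 zero) = vor va
  σ⁻¹ (pos r0 (suc q)) with compare⁺ q N
  ... | less  = neg r1 q
  ... | equal = pos r1 0
  ... | _     = vor va
  σ⁻¹ (pos r1 q) with compare⁺ q N
  ... | less    = pos r3 q
  ... | equal   = pos r2 N
  ... | succ    = vor vc
  ... | greater = vor va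
  σ⁻¹ (pos r2 q) with compare⁺ q N
  ... | less    = neg r3 (suc q)
  ... | equal   = vor vb
  ... | succ    = vor vd
  ... | greater = vor va
  σ⁻¹ (pos r3 zero) = neg r0 (suc N)
  σ⁻¹ (pos r3 (suc q)) with compare⁺ q N
  ... | less = pos r0 (suc q)
  ... | _    = vor va
  σ⁻¹ (neg r0 zero) = vor va
  σ⁻¹ (neg r0 (suc q)) with compare⁺ q N
  ... | less  = pos r1 (suc q)
  ... | equal = neg r1 (suc N)
  ... | _     = vor va
  σ⁻¹ (neg r1 zero) = pos r2 (suc N)
  σ⁻¹ (neg r1 (suc q)) with compare⁺ q N
  ... | less  = neg r2 q
  ... | equal = neg r2 (suc N)
  ... | _     = vor va
  σ⁻¹ (neg r2 q) with compare⁺ q N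
  ... | less    = neg r0 (suc q)
  ... | equal   = vor va
  ... | succ    = neg r3 0
  ... | greater = vor va
  σ⁻¹ (neg r3 q) with compare⁺ q N
  ... | less  = pos r2 q
  ... | equal = neg r2 N
  ... | _     = vor va

  σ⁻¹-σ : ∀ c → Valid c → σ⁻¹ (σ c) ≡ c
  σ⁻¹-σ (vor va) _ rewrite compare⁺-≡ N = refl
  σ⁻¹-σ (vor vb) _ rewrite compare⁺-≡ N = refl
  σ⁻¹-σ (vor vc) _ rewrite compare⁺-suc N = refl
  σ⁻¹-σ (vor vd) _ rewrite compare⁺-suc N = refl
  σ⁻¹-σ (pos r0 zero) (() , _)
  σ⁻¹-σ (pos r0 (suc q)) (_ , s≤s q≤N) with m≤n⇒m<n∨m≡n q≤N
  ... | inj₁ q<N rewrite compare⁺-< q<N | compare⁺-< q<N = refl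
  ... | inj₂ refl rewrite compare⁺-≡ N = refl
  σ⁻¹-σ (pos r1 zero) _ rewrite compare⁺-≡ N = refl
  σ⁻¹-σ (pos r1 (suc q)) (s≤s q≤N) with m≤n⇒m<n∨m≡n q≤N
  ... | inj₁ q<N rewrite compare⁺-< q<N | compare⁺-< q<N = refl
  ... | inj₂ refl rewrite compare⁺-≡ N = refl
  σ⁻¹-σ (pos r2 q) q≤1+N with upto q≤1+N
  ... | below q<N  rewrite compare⁺-< q<N | compare⁺-< q<N = refl
  ... | at refl    rewrite compare⁺-≡ N | compare⁺-≡ N = refl
  ... | above refl rewrite compare⁺-suc N = refl
  σ⁻¹-σ (pos r3 q) q≤N with m≤n⇒m<n∨m≡n q≤N
  ... | inj₁ q<N rewrite compare⁺-< q<N | compare⁺-< q<N = refl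
  ... | inj₂ refl rewrite compare⁺-≡ N = refl
  σ⁻¹-σ (neg r0 zero) (() , _)
  σ⁻¹-σ (neg r0 (suc q)) (_ , s≤s q≤N) with m≤n⇒m<n∨m≡n q≤N
  ... | inj₁ q<N rewrite compare⁺-< q<N | compare⁺-< q<N = refl
  ... | inj₂ refl rewrite compare⁺-≡ N = refl
  σ⁻¹-σ (neg r1 q) q≤1+N with upto q≤1+N
  ... | below q<N  rewrite compare⁺-< q<N | compare⁺-< q<N = refl
  ... | at refl    rewrite compare⁺-≡ N = refl
  ... | above refl rewrite compare⁺-suc N | compare⁺-≡ N = refl
  σ⁻¹-σ (neg r2 q) q≤1+N with upto q≤1+N
  ... | below q<N  rewrite compare⁺-< q<N | compare⁺-< q<N = refl
  ... | at refl    rewrite compare⁺-≡ N | compare⁺-≡ N = refl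
  ... | above refl rewrite compare⁺-suc N | compare⁺-≡ N = refl
  σ⁻¹-σ (neg r3 zero) _ rewrite compare⁺-suc N = refl
  σ⁻¹-σ (neg r3 (suc q)) q<N rewrite compare⁺-< q<N | compare⁺-< q<N = refl

  σ-valid : ∀ c → Valid c → Valid (σ c)
  σ-valid (vor va) _ = n≤1+n N
  σ-valid (vor vb) _ = n≤1+n N
  σ-valid (vor vc) _ = ≤-refl
  σ-valid (vor vd) _ = ≤-refl
  σ-valid (pos r0 zero) (() , _)
  σ-valid (pos r0 (suc q)) (_ , s≤s q≤N) with m≤n⇒m<n∨m≡n q≤N
  ... | inj₁ q<N rewrite compare⁺-< q<N = q<N
  ... | inj₂ refl rewrite compare⁺-≡ N = tt
  σ-valid (pos r1 zero) _ = z<s , ≤-refl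
  σ-valid (pos r1 (suc q)) (s≤s q≤N) with m≤n⇒m<n∨m≡n q≤N
  ... | inj₁ q<N rewrite compare⁺-< q<N = z<s , s≤s (<⇒≤ q<N)
  ... | inj₂ refl rewrite compare⁺-≡ N = tt
  σ-valid (pos r2 q) q≤1+N with upto q≤1+N
  ... | below q<N  rewrite compare⁺-< q<N = <⇒≤ q<N
  ... | at refl    rewrite compare⁺-≡ N = n≤1+n N
  ... | above refl rewrite compare⁺-suc N = z≤n
  σ-valid (pos r3 q) q≤N with m≤n⇒m<n∨m≡n q≤N
  ... | inj₁ q<N rewrite compare⁺-< q<N = m≤n⇒m≤1+n (<⇒≤ q<N)
  ... | inj₂ refl rewrite compare⁺-≡ N = tt
  σ-valid (neg r0 zero) (() , _)
  σ-valid (neg r0 (suc q)) (_ , s≤s q≤N) with m≤n⇒m<n∨m≡n q≤N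
  ... | inj₁ q<N rewrite compare⁺-< q<N = m≤n⇒m≤1+n (<⇒≤ q<N)
  ... | inj₂ refl rewrite compare⁺-≡ N = z≤n
  σ-valid (neg r1 q) q≤1+N with upto q≤1+N
  ... | below q<N  rewrite compare⁺-< q<N = z<s , s≤s (<⇒≤ q<N)
  ... | at refl    rewrite compare⁺-≡ N = tt
  ... | above refl rewrite compare⁺-suc N = z<s , ≤-refl
  σ-valid (neg r2 q) q≤1+N with upto q≤1+N
  ... | below q<N  rewrite compare⁺-< q<N = s≤s (<⇒≤ q<N)
  ... | at refl    rewrite compare⁺-≡ N = ≤-refl
  ... | above refl rewrite compare⁺-suc N = ≤-refl
  σ-valid (neg r3 zero) _ = ≤-refl
  σ-valid (neg r3 (suc q)) q<N rewrite compare⁺-< q<N = m≤n⇒m≤1+n (<⇒≤ q<N)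

  σ[+0]< : ∀ {i} → i < N → σ (pos r0 (suc i)) ≡ pos r3 (suc i)
  σ[+0]< i<N rewrite compare⁺-< i<N = refl
  σ[+0]= : σ (pos r0 (suc N)) ≡ vor vc
  σ[+0]= rewrite compare⁺-≡ N = refl
  σ[+1]< : ∀ {i} → i < N → σ (pos r1 (suc i)) ≡ neg r0 (suc i)
  σ[+1]< i<N rewrite compare⁺-< i<N = refl
  σ[+1]= : σ (pos r1 (suc N)) ≡ vor vd
  σ[+1]= rewrite compare⁺-≡ N = refl
  σ[+2]< : ∀ {q} → q < N → σ (pos r2 q) ≡ neg r3 q
  σ[+2]< q<N rewrite compare⁺-< q<N = refl
  σ[+2]= : σ (pos r2 N) ≡ pos r1 N
  σ[+2]= rewrite compare⁺-≡ N = refl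
  σ[+2]+ : σ (pos r2 (suc N)) ≡ neg r1 0
  σ[+2]+ rewrite compare⁺-suc N = refl
  σ[+3]< : ∀ {q} → q < N → σ (pos r3 q) ≡ pos r1 q
  σ[+3]< q<N rewrite compare⁺-< q<N = refl
  σ[+3]= : σ (pos r3 N) ≡ vor vb
  σ[+3]= rewrite compare⁺-≡ N = refl
  σ[-0]< : ∀ {i} → i < N → σ (neg r0 (suc i)) ≡ neg r2 i
  σ[-0]< i<N rewrite compare⁺-< i<N = refl
  σ[-0]= : σ (neg r0 (suc N)) ≡ pos r3 0
  σ[-0]= rewrite compare⁺-≡ N = refl
  σ[-1]< : ∀ {q} → q < N → σ (neg r1 q) ≡ pos r0 (suc q)
  σ[-1]< q<N rewrite compare⁺-< q<N = refl
  σ[-1]= : σ (neg r1 N) ≡ vor va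
  σ[-1]= rewrite compare⁺-≡ N = refl
  σ[-1]+ : σ (neg r1 (suc N)) ≡ neg r0 (suc N)
  σ[-1]+ rewrite compare⁺-suc N = refl
  σ[-2]< : ∀ {q} → q < N → σ (neg r2 q) ≡ neg r1 (suc q)
  σ[-2]< q<N rewrite compare⁺-< q<N = refl
  σ[-2]= : σ (neg r2 N) ≡ neg r3 N
  σ[-2]= rewrite compare⁺-≡ N = refl
  σ[-2]+ : σ (neg r2 (suc N)) ≡ neg r1 (suc N)
  σ[-2]+ rewrite compare⁺-suc N = refl
  σ[-3]< : ∀ {i} → i < N → σ (neg r3 (suc i)) ≡ pos r2 i
  σ[-3]< i<N rewrite compare⁺-< i<N = refl

  next : BaseDart → BaseDart
  next (along (pos r q)) = along (σ (neg r q))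
  next (along (neg r q)) = along (σ (pos r q))
  next (along (vor x))   = out x
  next (out x)           = along (σ (vor x))

  Good : BaseDart → Set
  Good (along c) = Valid c
  Good (out _)   = ⊤

  next-good : ∀ t → Good t → Good (next t)
  next-good (along (pos r q)) valid = σ-valid (neg r q) valid
  next-good (along (neg r q)) valid = σ-valid (pos r q) valid
  next-good (along (vor x))   _     = tt
  next-good (out x)           _     = σ-valid (vor x) tt

  record Square : Set where
    field
      a b c d    : BaseDart
      a→b        : next a ≡ b
      b→c        : next b ≡ c
      c→d        : next c ≡ d
      d→a        : next d ≡ a
      a≢b        : a ≢ b
      a≢c        : a ≢ c
      a≢d        : a ≢ d
      b≢c        : b ≢ c
      b≢d        : b ≢ d
      c≢d        : c ≢ d
      balanced   : plusPart a + plusPart b + plusPart c + plusPart d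
                 ≡ minusPart a + minusPart b + minusPart c + minusPart d

  rotate : Square → Square
  rotate s = record
    { a = b ; b = c ; c = d ; d = a
    ; a→b = b→c ; b→c = c→d ; c→d = d→a ; d→a = a→b
    ; a≢b = b≢c ; a≢c = b≢d ; a≢d = a≢b ∘ sym
    ; b≢c = c≢d ; b≢d = a≢c ∘ sym ; c≢d = a≢d ∘ sym
    ; balanced = trans (sym (rotate₄ (plusPart a) _ _ _)) (trans balanced (rotate₄ (minusPart a) _ _ _))
    }
    where
    open Square s
    rotate₄ : ∀ w x y z → w + x + y + z ≡ x + y + z + w
    rotate₄ = solve-∀

  lower-square : ∀ j → j < N → Square
  lower-square j j<N = record
    { a = along (pos r1 j) ; b = along (pos r0 (suc j)) ; c = along (neg r2 j) ; d = along (neg r3 j)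
    ; a→b = cong along (σ[-1]< j<N) ; b→c = cong along (σ[-0]< j<N)
    ; c→d = cong along (σ[+2]< j<N) ; d→a = cong along (σ[+3]< j<N)
    ; a≢b = λ () ; a≢c = λ () ; a≢d = λ () ; b≢c = λ () ; b≢d = λ () ; c≢d = λ ()
    ; balanced = sums j
    }
    where
    sums : ∀ j → j * 4 + 1 + (suc j * 4 + 0) + 0 + 0 ≡ 0 + 0 + (j * 4 + 2) + (j * 4 + 3)
    sums = solve-∀

  upper-square : ∀ j → j < N → Square
  upper-square j j<N = record
    { a = along (pos r3 (suc j)) ; b = along (pos r2 j) ; c = along (neg r1 (suc j)) ; d = along (neg r0 (suc j))
    ; a→b = cong along (σ[-3]< j<N) ; b→c = cong along (σ[-2]< j<N)
    ; c→d = cong along (σ[+1]< j<N) ; d→a = cong along (σ[+0]< j<N)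
    ; a≢b = λ () ; a≢c = λ () ; a≢d = λ () ; b≢c = λ () ; b≢d = λ () ; c≢d = λ ()
    ; balanced = sums j
    }
    where
    sums : ∀ j → suc j * 4 + 3 + (j * 4 + 2) + 0 + 0 ≡ 0 + 0 + (suc j * 4 + 1) + (suc j * 4 + 0)
    sums = solve-∀

  top-square : Square
  top-square = record
    { a = along (pos r3 0) ; b = along (neg r2 (suc N)) ; c = along (neg r1 0) ; d = along (pos r0 (suc N))
    ; a→b = refl ; b→c = cong along σ[+2]+ ; c→d = refl ; d→a = cong along σ[-0]=
    ; a≢b = λ () ; a≢c = λ () ; a≢d = λ () ; b≢c = λ () ; b≢d = λ () ; c≢d = λ ()
    ; balanced = sums N
    }
    where
    sums : ∀ N → 0 * 4 + 3 + 0 + 0 + (suc N * 4 + 0) ≡ 0 + (suc N * 4 + 2) + (0 * 4 + 1) + 0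
    sums = solve-∀

  into : Vortex → Current
  into va = pos r1 N
  into vb = neg r3 N
  into vc = neg r0 (suc N)
  into vd = neg r1 (suc N)

  vortex-square : Vortex → Square
  vortex-square x = record
    { a = along (into x) ; b = along (vor x) ; c = out x ; d = along (σ (vor x))
    ; a→b = into-next x ; b→c = refl ; c→d = refl ; d→a = σ-next x
    ; a≢b = into-≢ x ; a≢c = λ () ; a≢d = into-≢-σ x ; b≢c = λ () ; b≢d = vor-≢-σ x ; c≢d = λ ()
    ; balanced = sums x
    }
    where
    into-next : ∀ x → next (along (into x)) ≡ along (vor x)
    into-next va = cong along σ[-1]=
    into-next vb = cong along σ[+3]=
    into-next vc = cong along σ[+0]=
    into-next vd = cong along σ[+1]=
    σ-next : ∀ x → next (along (σ (vor x))) ≡ along (into x)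
    σ-next va = cong along σ[+2]=
    σ-next vb = cong along σ[-2]=
    σ-next vc = cong along σ[-1]+
    σ-next vd = cong along σ[-2]+
    into-≢ : ∀ x → along (into x) ≢ along (vor x)
    into-≢ va ()
    into-≢ vb ()
    into-≢ vc ()
    into-≢ vd ()
    into-≢-σ : ∀ x → along (into x) ≢ along (σ (vor x))
    into-≢-σ va ()
    into-≢-σ vb ()
    into-≢-σ vc ()
    into-≢-σ vd ()
    vor-≢-σ : ∀ x → along (vor x) ≢ along (σ (vor x))
    vor-≢-σ va ()
    vor-≢-σ vb ()
    vor-≢-σ vc ()
    vor-≢-σ vd ()
    sums : ∀ x → plusPart (along (into x)) + plusPart (along (vor x)) + 0 + plusPart (along (σ (vor x)))
               ≡ minusPart (along (into x)) + minusPart (along (vor x)) + 0 + minusPart (along (σ (vor x)))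
    sums va = lemma N
      where lemma : ∀ N → N * 4 + 1 + 1 + 0 + 0 ≡ 0 + 0 + 0 + (N * 4 + 2)
            lemma = solve-∀
    sums vb = lemma N
      where lemma : ∀ N → 0 + 1 + 0 + (N * 4 + 2) ≡ N * 4 + 3 + 0 + 0 + 0
            lemma = solve-∀
    sums vc = lemma N
      where lemma : ∀ N → 0 + 0 + 0 + (suc N * 4 + 1) ≡ suc N * 4 + 0 + 1 + 0 + 0
            lemma = solve-∀
    sums vd = lemma N
      where lemma : ∀ N → 0 + 0 + 0 + (suc N * 4 + 2) ≡ suc N * 4 + 1 + 1 + 0 + 0
            lemma = solve-∀

  SquareAt : BaseDart → Set
  SquareAt t = Σ Square (λ s → Square.a s ≡ t)

  square-at : ∀ t → Good t → SquareAt t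
  square-at (along (pos r0 zero)) (() , _)
  square-at (along (pos r0 (suc i))) (_ , s≤s i≤N) with m≤n⇒m<n∨m≡n i≤N
  ... | inj₁ i<N  = rotate (lower-square i i<N) , refl
  ... | inj₂ refl = rotate (rotate (rotate top-square)) , refl
  square-at (along (pos r1 q)) q≤1+N with upto q≤1+N
  ... | below q<N  = lower-square q q<N , refl
  ... | at refl    = vortex-square va , refl
  ... | above refl = rotate (rotate (rotate (vortex-square vc))) , refl
  square-at (along (pos r2 q)) q≤1+N with upto q≤1+N
  ... | below q<N  = rotate (upper-square q q<N) , refl
  ... | at refl    = rotate (rotate (rotate (vortex-square vb))) , refl
  ... | above refl = rotate (rotate (rotate (vortex-square vd))) , refl
  square-at (along (pos r3 zero))    _   = top-square , refl
  square-at (along (pos r3 (suc i))) i<N = upper-square i i<N , refl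
  square-at (along (neg r0 zero)) (() , _)
  square-at (along (neg r0 (suc i))) (_ , s≤s i≤N) with m≤n⇒m<n∨m≡n i≤N
  ... | inj₁ i<N  = rotate (rotate (rotate (upper-square i i<N))) , refl
  ... | inj₂ refl = vortex-square vc , refl
  square-at (along (neg r1 zero))    _   = rotate (rotate top-square) , refl
  square-at (along (neg r1 (suc i))) (s≤s i≤N) with m≤n⇒m<n∨m≡n i≤N
  ... | inj₁ i<N  = rotate (rotate (upper-square i i<N)) , refl
  ... | inj₂ refl = vortex-square vd , refl
  square-at (along (neg r2 q)) q≤1+N with upto q≤1+N
  ... | below q<N  = rotate (rotate (lower-square q q<N)) , refl
  ... | at refl    = rotate (rotate (rotate (vortex-square va))) , refl
  ... | above refl = rotate top-square , refl
  square-at (along (neg r3 q)) q≤N with m≤n⇒m<n∨m≡n q≤N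
  ... | inj₁ q<N  = rotate (rotate (rotate (lower-square q q<N))) , refl
  ... | inj₂ refl = vortex-square vb , refl
  square-at (along (vor x)) _ = rotate (vortex-square x) , refl
  square-at (out x)         _ = rotate (rotate (vortex-square x)) , refl

module ReachPositive (N′ : ℕ) where
  private
    N : ℕ
    N = suc N′
  open CurrentGraph N
  open Reachability σ

  descend : ∀ m j → m + j ≤ N → neg r3 (m + j) ↝ neg r3 j
  descend zero    j _ = ↝-refl
  descend (suc m) j h = ↝-trans (↝-refl ▸ σ[-3]< h ▸ σ[+2]< h) (descend m j (<⇒≤ h))

  to-neg3 : ∀ q → q ≤ N → vor va ↝ neg r3 q
  to-neg3 q q≤N = ↝-trans (↝-refl ▸ refl ▸ σ[-2]=)
    (subst (λ t → neg r3 t ↝ neg r3 q) (m∸n+n≡m q≤N) (descend (N ∸ q) q (≤-reflexive (m∸n+n≡m q≤N))))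

  to-neg2-top : vor va ↝ neg r2 (suc N)
  to-neg2-top = to-neg3 0 z≤n ▸ refl

  to-neg1-top : vor va ↝ neg r1 (suc N)
  to-neg1-top = to-neg2-top ▸ σ[-2]+

  to-neg0-top : vor va ↝ neg r0 (suc N)
  to-neg0-top = to-neg1-top ▸ σ[-1]+

  to-pos3-0 : vor va ↝ pos r3 0
  to-pos3-0 = to-neg0-top ▸ σ[-0]=

  to-pos1-0 : vor va ↝ pos r1 0
  to-pos1-0 = to-pos3-0 ▸ σ[+3]< z<s

  to-pos0-top : vor va ↝ pos r0 (suc N)
  to-pos0-top = to-pos1-0 ▸ refl

  to-vc : vor va ↝ vor vc
  to-vc = to-pos0-top ▸ σ[+0]=

  to-pos1-top : vor va ↝ pos r1 (suc N)
  to-pos1-top = to-vc ▸ refl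

  to-vd : vor va ↝ vor vd
  to-vd = to-pos1-top ▸ σ[+1]=

  to-pos2-top : vor va ↝ pos r2 (suc N)
  to-pos2-top = to-vd ▸ refl

  to-neg1-0 : vor va ↝ neg r1 0
  to-neg1-0 = to-pos2-top ▸ σ[+2]+

  pos3→pos1 : ∀ i → i < N → pos r3 (suc i) ↝ pos r1 (suc i)
  pos3→pos1 i (s≤s i≤N′) with m≤n⇒m<n∨m≡n i≤N′
  ... | inj₁ i<N′ = ↝-refl ▸ σ[+3]< (s≤s i<N′)
  ... | inj₂ refl = ↝-refl ▸ σ[+3]= ▸ refl ▸ σ[+2]=

  to-pos0 : ∀ i → i < N → vor va ↝ pos r0 (suc i)
  to-pos0 zero    _   = to-neg1-0 ▸ σ[-1]< z<s
  to-pos0 (suc i) 1+i<N = ↝-trans (to-pos0 i i<N ▸ σ[+0]< i<N) (pos3→pos1 i i<N)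
                        ▸ σ[+1]< i<N ▸ σ[-0]< i<N ▸ σ[-2]< i<N ▸ σ[-1]< 1+i<N
    where
    i<N : i < N
    i<N = <-trans (n<1+n i) 1+i<N

  to-pos3 : ∀ i → i < N → vor va ↝ pos r3 (suc i)
  to-pos3 i i<N = to-pos0 i i<N ▸ σ[+0]< i<N

  to-pos1 : ∀ i → i < N → vor va ↝ pos r1 (suc i)
  to-pos1 i i<N = ↝-trans (to-pos3 i i<N) (pos3→pos1 i i<N)

  to-neg0 : ∀ i → i < N → vor va ↝ neg r0 (suc i)
  to-neg0 i i<N = to-pos1 i i<N ▸ σ[+1]< i<N

  to-neg2 : ∀ i → i < N → vor va ↝ neg r2 i
  to-neg2 i i<N = to-neg0 i i<N ▸ σ[-0]< i<N

  to-neg1 : ∀ i → i < N → vor va ↝ neg r1 (suc i)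
  to-neg1 i i<N = to-neg2 i i<N ▸ σ[-2]< i<N

  to-vb : vor va ↝ vor vb
  to-vb = to-pos3 N′ ≤-refl ▸ σ[+3]=

  reach : ∀ c → Valid c → vor va ↝ c
  reach (vor va) _ = ↝-refl
  reach (vor vb) _ = to-vb
  reach (vor vc) _ = to-vc
  reach (vor vd) _ = to-vd
  reach (pos r0 zero) (() , _)
  reach (pos r0 (suc i)) (_ , s≤s i≤N) with m≤n⇒m<n∨m≡n i≤N
  ... | inj₁ i<N  = to-pos0 i i<N
  ... | inj₂ refl = to-pos0-top
  reach (pos r1 zero) _ = to-pos1-0
  reach (pos r1 (suc i)) (s≤s i≤N) with m≤n⇒m<n∨m≡n i≤N
  ... | inj₁ i<N  = to-pos1 i i<N
  ... | inj₂ refl = to-pos1-top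
  reach (pos r2 q) q≤1+N with upto q≤1+N
  ... | below q<N  = to-neg3 (suc q) q<N ▸ σ[-3]< q<N
  ... | at refl    = to-vb ▸ refl
  ... | above refl = to-pos2-top
  reach (pos r3 zero) _ = to-pos3-0
  reach (pos r3 (suc i)) i<N = to-pos3 i i<N
  reach (neg r0 zero) (() , _)
  reach (neg r0 (suc i)) (_ , s≤s i≤N) with m≤n⇒m<n∨m≡n i≤N
  ... | inj₁ i<N  = to-neg0 i i<N
  ... | inj₂ refl = to-neg0-top
  reach (neg r1 zero) _ = to-neg1-0
  reach (neg r1 (suc i)) (s≤s i≤N) with m≤n⇒m<n∨m≡n i≤N
  ... | inj₁ i<N  = to-neg1 i i<N
  ... | inj₂ refl = to-neg1-top
  reach (neg r2 q) q≤1+N with upto q≤1+N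
  ... | below q<N  = to-neg2 q q<N
  ... | at refl    = ↝-refl ▸ refl
  ... | above refl = to-neg2-top
  reach (neg r3 q) q≤N = to-neg3 q q≤N

  loop : ∃[ T ] iter σ (suc T) (vor va) ≡ vor va
  loop with k , σᵏ ← to-neg1 N′ ≤-refl = k , trans (cong σ σᵏ) σ[-1]=

module ReachZero where
  open CurrentGraph 0
  open Reachability σ

  reach : ∀ c → Valid c → vor va ↝ c
  reach (vor va)              _ = 0 , refl
  reach (neg r2 zero)         _ = 1 , refl
  reach (neg r3 zero)         _ = 2 , refl
  reach (neg r2 (suc zero))   _ = 3 , refl
  reach (neg r1 (suc zero))   _ = 4 , refl
  reach (neg r0 (suc zero))   _ = 5 , refl
  reach (pos r3 zero)         _ = 6 , refl
  reach (vor vb)              _ = 7 , refl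
  reach (pos r2 zero)         _ = 8 , refl
  reach (pos r1 zero)         _ = 9 , refl
  reach (pos r0 (suc zero))   _ = 10 , refl
  reach (vor vc)              _ = 11 , refl
  reach (pos r1 (suc zero))   _ = 12 , refl
  reach (vor vd)              _ = 13 , refl
  reach (pos r2 (suc zero))   _ = 14 , refl
  reach (neg r1 zero)         _ = 15 , refl
  reach (pos r0 zero)               (() , _)
  reach (pos r0 (suc (suc _)))      (_ , s≤s ())
  reach (pos r1 (suc (suc _)))      (s≤s ())
  reach (pos r2 (suc (suc _)))      (s≤s ())
  reach (pos r3 (suc _))            ()
  reach (neg r0 zero)               (() , _)
  reach (neg r0 (suc (suc _)))      (_ , s≤s ())
  reach (neg r1 (suc (suc _)))      (s≤s ())
  reach (neg r2 (suc (suc _)))      (s≤s ())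
  reach (neg r3 (suc _))            ()

  loop : ∃[ T ] iter σ (suc T) (vor va) ≡ vor va
  loop = 15 , refl

σ-cyclic : ∀ N → let open CurrentGraph N in CyclicOn Valid σ
σ-cyclic zero    = cyclicOn-fromBase {g = σ⁻¹} σ-valid σ⁻¹-σ loop reach
  where open CurrentGraph 0
        open ReachZero
σ-cyclic (suc N′) = cyclicOn-fromBase {g = σ⁻¹} σ-valid σ⁻¹-σ loop reach
  where open CurrentGraph (suc N′)
        open ReachPositive N′

-- The derived embedding of K_{8s+1} − K₄

balanced-sum : ∀ {A : Set} n (s m p k : A → ℕ) a b c d →
  s a + m a ≡ p a + k a * n → s b + m b ≡ p b + k b * n → s c + m c ≡ p c + k c * n → s d + m d ≡ p d + k d * n →
  p a + p b + p c + p d ≡ m a + m b + m c + m d → s a + s b + s c + s d ≡ (k a + k b + k c + k d) * n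
balanced-sum n s m p k a b c d eq-a eq-b eq-c eq-d balanced = +-cancelʳ-≡ (m a + m b + m c + m d) _ _ (begin
  s a + s b + s c + s d + (m a + m b + m c + m d)                          ≡⟨ regroup (s a) (s b) (s c) (s d) (m a) (m b) (m c) (m d) ⟩
  (s a + m a) + (s b + m b) + (s c + m c) + (s d + m d)                    ≡⟨ cong₂ _+_ (cong₂ _+_ (cong₂ _+_ eq-a eq-b) eq-c) eq-d ⟩
  (p a + k a * n) + (p b + k b * n) + (p c + k c * n) + (p d + k d * n)    ≡⟨ collect (p a) (p b) (p c) (p d) (k a) (k b) (k c) (k d) n ⟩
  p a + p b + p c + p d + (k a + k b + k c + k d) * n                      ≡⟨ cong (_+ (k a + k b + k c + k d) * n) balanced ⟩
  m a + m b + m c + m d + (k a + k b + k c + k d) * n                      ≡⟨ +-comm (m a + m b + m c + m d) _ ⟩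
  (k a + k b + k c + k d) * n + (m a + m b + m c + m d)                    ∎)
  where
  open ≡-Reasoning
  regroup : ∀ s₁ s₂ s₃ s₄ m₁ m₂ m₃ m₄ →
    s₁ + s₂ + s₃ + s₄ + (m₁ + m₂ + m₃ + m₄) ≡ (s₁ + m₁) + (s₂ + m₂) + (s₃ + m₃) + (s₄ + m₄)
  regroup = solve-∀
  collect : ∀ p₁ p₂ p₃ p₄ k₁ k₂ k₃ k₄ n →
    (p₁ + k₁ * n) + (p₂ + k₂ * n) + (p₃ + k₃ * n) + (p₄ + k₄ * n) ≡ p₁ + p₂ + p₃ + p₄ + (k₁ + k₂ + k₃ + k₄) * n
  collect = solve-∀

module Embedding (N : ℕ) where
  open CurrentGraph N

  -- N = s − 2, so that n = 2M + 1 = 8s − 3.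
  n : ℕ
  n = suc (M + M)

  open Translation n

  M<n : M < n
  M<n = s≤s (m≤m+n M M)

  -- disp c ∈ [0, n) represents c in ℤₙ (for vor x: the step of the rotation at vortex x).
  disp : Current → ℕ
  disp (pos r q) = magnitude r q
  disp (neg r q) = n ∸ magnitude r q
  disp (vor va)  = 1
  disp (vor vb)  = 1
  disp (vor vc)  = n ∸ 1
  disp (vor vd)  = n ∸ 1

  Ordinary : Current → Set
  Ordinary (vor _) = ⊥
  Ordinary _       = ⊤

  signed : ℕ → Current
  signed d with d ≤? M
  ... | yes _ = uncurry pos (divMod4 d)
  ... | no _  = uncurry neg (divMod4 (n ∸ d))

  private
    magnitude<n : ∀ r q → InRange r q → magnitude r q < n
    magnitude<n r q inRange = ≤-<-trans (proj₂ (magnitude-bounds r q inRange)) M<n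

  disp-signed : ∀ d → d < n → disp (signed d) ≡ d
  disp-signed d d<n with d ≤? M
  ... | yes _ = magnitude-divMod4 d
  ... | no _  = trans (cong (n ∸_) (magnitude-divMod4 (n ∸ d))) (m∸[m∸n]≡n (<⇒≤ d<n))

  signed-disp : ∀ c → Valid c → Ordinary c → signed (disp c) ≡ c
  signed-disp (pos r q) valid _ with magnitude r q ≤? M
  ... | yes _  = cong (uncurry pos) (divMod4-magnitude r q)
  ... | no ≰M  = ⊥-elim (≰M (proj₂ (magnitude-bounds r q valid)))
  signed-disp (neg r q) valid _ with n ∸ magnitude r q ≤? M
  ... | yes ≤M = ⊥-elim (<⇒≱ (m+n≤o⇒m≤o∸n (suc M) (s≤s (+-monoʳ-≤ M (proj₂ (magnitude-bounds r q valid))))) ≤M)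
  ... | no _   = cong (uncurry neg) (trans (cong divMod4 (m∸[m∸n]≡n (<⇒≤ (magnitude<n r q valid)))) (divMod4-magnitude r q))

  signed-valid : ∀ d → 0 < d → d < n → Valid (signed d) × Ordinary (signed d)
  signed-valid d 0<d d<n with d ≤? M
  ... | yes d≤M = valid-pos (divMod4 d) (magnitude-divMod4 d)
    where
    valid-pos : ∀ rq → uncurry magnitude rq ≡ d → Valid (uncurry pos rq) × Ordinary (uncurry pos rq)
    valid-pos (r , q) refl = inRange r q 0<d d≤M , tt
  ... | no d≰M = valid-neg (divMod4 (n ∸ d)) (magnitude-divMod4 (n ∸ d))
    where
    n∸d≤M : n ∸ d ≤ M
    n∸d≤M = ≤-trans (∸-monoʳ-≤ n (≰⇒> d≰M)) (≤-reflexive (m+n∸n≡m M M))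
    valid-neg : ∀ rq → uncurry magnitude rq ≡ n ∸ d → Valid (uncurry neg rq) × Ordinary (uncurry neg rq)
    valid-neg (r , q) eq = inRange r q (subst (1 ≤_) (sym eq) (m<n⇒0<n∸m d<n)) (subst (_≤ M) (sym eq) n∸d≤M) , tt

  disp<n : ∀ c → Valid c → Ordinary c → disp c < n
  disp<n (pos r q) valid _ = magnitude<n r q valid
  disp<n (neg r q) valid _ = ∸-monoʳ-< {n} {magnitude r q} {0} (proj₁ (magnitude-bounds r q valid)) (<⇒≤ (magnitude<n r q valid))

  disp+disp-reverse : ∀ c → Valid c → Ordinary c → disp c + disp (reverse c) ≡ n
  disp+disp-reverse (pos r q) valid _ = m+[n∸m]≡n (<⇒≤ (magnitude<n r q valid))
  disp+disp-reverse (neg r q) valid _ = m∸n+n≡m (<⇒≤ (magnitude<n r q valid))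

  current : Fin n → Fin n → Current
  current w w′ = signed (w′ ⊖ w)

  ⊕-current : ∀ w w′ → w ⊕ disp (current w w′) ≡ w′
  ⊕-current w w′ = trans (cong (w ⊕_) (disp-signed (w′ ⊖ w) (⊖-< w′ w))) (⊕-⊖ w w′)

  current-⊕ : ∀ w c → Valid c → Ordinary c → current w (w ⊕ disp c) ≡ c
  current-⊕ w c valid ord = trans (cong signed (⊕-⊖-cancel w (disp<n c valid ord))) (signed-disp c valid ord)

  current-valid : ∀ {w w′} → w ≢ w′ → Valid (current w w′) × Ordinary (current w w′)
  current-valid {w} {w′} w≢w′ = signed-valid (w′ ⊖ w) (n≢0⇒n>0 nonzero) (⊖-< w′ w)
    where
    nonzero : w′ ⊖ w ≢ 0
    nonzero w′⊖w≡0 = w≢w′ (trans (sym (⊕-identityʳ w)) (trans (cong (w ⊕_) (sym w′⊖w≡0)) (⊕-⊖ w w′)))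

  0<disp : ∀ c → Valid c → Ordinary c → 0 < disp c
  0<disp (pos r q) valid _ = proj₁ (magnitude-bounds r q valid)
  0<disp (neg r q) valid _ = m<n⇒0<n∸m (magnitude<n r q valid)

  ⊕-disp-≢ : ∀ w c → Valid c → Ordinary c → w ⊕ disp c ≢ w
  ⊕-disp-≢ w c valid ord eq = <⇒≢ (0<disp c valid ord) (begin
    0                    ≡⟨ ⊖-self w ⟨
    w ⊖ w                ≡⟨ cong (_⊖ w) eq ⟨
    (w ⊕ disp c) ⊖ w     ≡⟨ ⊕-⊖-cancel w (disp<n c valid ord) ⟩
    disp c               ∎)
    where open ≡-Reasoning

  reverse-valid : ∀ c → Valid c → Ordinary c → Valid (reverse c) × Ordinary (reverse c)
  reverse-valid (pos r q) valid _ = valid , tt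
  reverse-valid (neg r q) valid _ = valid , tt

  current-reverse : ∀ {w w′} → w ≢ w′ → current w′ w ≡ reverse (current w w′)
  current-reverse {w} {w′} w≢w′ = begin
    current w′ w                           ≡⟨ cong (current w′) back ⟨
    current w′ (w′ ⊕ disp (reverse c))     ≡⟨ current-⊕ w′ (reverse c) (proj₁ rev-valid) (proj₂ rev-valid) ⟩
    reverse c                              ∎
    where
    open ≡-Reasoning
    c : Current
    c = current w w′
    c-valid : Valid c × Ordinary c
    c-valid = current-valid w≢w′
    rev-valid : Valid (reverse c) × Ordinary (reverse c)
    rev-valid = reverse-valid c (proj₁ c-valid) (proj₂ c-valid)
    back : w′ ⊕ disp (reverse c) ≡ w
    back = begin
      w′ ⊕ disp (reverse c)                ≡⟨ cong (_⊕ disp (reverse c)) (⊕-current w w′) ⟨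
      w ⊕ disp c ⊕ disp (reverse c)        ≡⟨ ⊕-⊕ w (disp c) (disp (reverse c)) ⟩
      w ⊕ (disp c + disp (reverse c))      ≡⟨ cong (w ⊕_) (trans (disp+disp-reverse c (proj₁ c-valid) (proj₂ c-valid)) (sym (*-identityˡ n))) ⟩
      w ⊕ 1 * n                            ≡⟨ ⊕-multiple w 1 ⟩
      w                                    ∎

  p : ℕ
  p = 4 + n

  ord : Fin n → Fin p
  ord w = suc (suc (suc (suc w)))

  vtx : Vortex → Fin p
  vtx va = zero
  vtx vb = suc zero
  vtx vc = suc (suc zero)
  vtx vd = suc (suc (suc zero))

  data VertexView : Fin p → Set where
    vortex   : ∀ x → VertexView (vtx x)
    ordinary : ∀ w → VertexView (ord w)

  view : ∀ v → VertexView v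
  view zero                       = vortex va
  view (suc zero)                 = vortex vb
  view (suc (suc zero))           = vortex vc
  view (suc (suc (suc zero)))     = vortex vd
  view (suc (suc (suc (suc w))))  = ordinary w

  -- junk on the vortices
  unord : Fin p → Fin n
  unord (suc (suc (suc (suc w)))) = w
  unord _                         = zero

  endpoint : Fin n → Current → Fin p
  endpoint w (vor x)   = vtx x
  endpoint w (pos r q) = ord (w ⊕ disp (pos r q))
  endpoint w (neg r q) = ord (w ⊕ disp (neg r q))

  currentTo : Fin n → Fin p → Current
  currentTo w zero                        = vor va
  currentTo w (suc zero)                  = vor vb
  currentTo w (suc (suc zero))            = vor vc
  currentTo w (suc (suc (suc zero)))      = vor vd
  currentTo w (suc (suc (suc (suc w′)))) = current w w′

  rot : Fin p → Fin p → Fin p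
  rot zero                       v = ord (unord v ⊕ disp (vor va))
  rot (suc zero)                 v = ord (unord v ⊕ disp (vor vb))
  rot (suc (suc zero))           v = ord (unord v ⊕ disp (vor vc))
  rot (suc (suc (suc zero)))     v = ord (unord v ⊕ disp (vor vd))
  rot (suc (suc (suc (suc w))))  v = endpoint w (σ (currentTo w v))

  ord-injective : ∀ {w w′} → ord w ≡ ord w′ → w ≡ w′
  ord-injective refl = refl

  vtx≢ord : ∀ x w → vtx x ≢ ord w
  vtx≢ord va w ()
  vtx≢ord vb w ()
  vtx≢ord vc w ()
  vtx≢ord vd w ()

  vtx-deleted : ∀ x → toℕ (vtx x) < 4
  vtx-deleted va = s≤s z≤n
  vtx-deleted vb = s≤s (s≤s z≤n)
  vtx-deleted vc = s≤s (s≤s (s≤s z≤n))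
  vtx-deleted vd = s≤s (s≤s (s≤s (s≤s z≤n)))

  ord-kept : ∀ w → ¬ toℕ (ord w) < 4
  ord-kept w (s≤s (s≤s (s≤s (s≤s ()))))

  adj-vtx-ord : ∀ x w → Adj p 4 (vtx x) (ord w)
  adj-vtx-ord x w = vtx≢ord x w , ord-kept w ∘ proj₂

  adj-ord-vtx : ∀ w x → Adj p 4 (ord w) (vtx x)
  adj-ord-vtx w x = vtx≢ord x w ∘ sym , ord-kept w ∘ proj₁

  adj-ord-ord : ∀ {w w′} → w ≢ w′ → Adj p 4 (ord w) (ord w′)
  adj-ord-ord {w} w≢w′ = w≢w′ ∘ ord-injective , ord-kept w ∘ proj₁

  ¬adj-vtx-vtx : ∀ x y → ¬ Adj p 4 (vtx x) (vtx y)
  ¬adj-vtx-vtx x y (_ , ¬deleted) = ¬deleted (vtx-deleted x , vtx-deleted y)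

  currentTo-vtx : ∀ w x → currentTo w (vtx x) ≡ vor x
  currentTo-vtx w va = refl
  currentTo-vtx w vb = refl
  currentTo-vtx w vc = refl
  currentTo-vtx w vd = refl

  endpoint-ordinary : ∀ w c → Ordinary c → endpoint w c ≡ ord (w ⊕ disp c)
  endpoint-ordinary w (pos r q) _ = refl
  endpoint-ordinary w (neg r q) _ = refl

  endpoint-adj : ∀ w c → Valid c → Adj p 4 (ord w) (endpoint w c)
  endpoint-adj w (vor x)   _     = adj-ord-vtx w x
  endpoint-adj w (pos r q) valid = adj-ord-ord (⊕-disp-≢ w (pos r q) valid tt ∘ sym)
  endpoint-adj w (neg r q) valid = adj-ord-ord (⊕-disp-≢ w (neg r q) valid tt ∘ sym)

  currentTo-valid : ∀ w v → Adj p 4 (ord w) v → Valid (currentTo w v)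
  currentTo-valid w v adj with view v
  ... | vortex x   rewrite currentTo-vtx w x = tt
  ... | ordinary w′ = proj₁ (current-valid (proj₁ adj ∘ cong ord))

  currentTo-endpoint : ∀ w c → Valid c → currentTo w (endpoint w c) ≡ c
  currentTo-endpoint w (vor x)   _     = currentTo-vtx w x
  currentTo-endpoint w (pos r q) valid = current-⊕ w (pos r q) valid tt
  currentTo-endpoint w (neg r q) valid = current-⊕ w (neg r q) valid tt

  endpoint-currentTo : ∀ w v → Adj p 4 (ord w) v → endpoint w (currentTo w v) ≡ v
  endpoint-currentTo w v adj with view v
  ... | vortex x   rewrite currentTo-vtx w x = refl
  ... | ordinary w′ = trans (endpoint-ordinary w (current w w′) (proj₂ (current-valid (proj₁ adj ∘ cong ord))))
                            (cong ord (⊕-current w w′))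

  ord-unord : ∀ x v → Adj p 4 (vtx x) v → ord (unord v) ≡ v
  ord-unord x v adj with view v
  ... | vortex y    = ⊥-elim (¬adj-vtx-vtx x y adj)
  ... | ordinary w = refl

  vortex-cyclic : ∀ x → CyclicOn (λ _ → ⊤) (_⊕ disp (vor x))
  vortex-cyclic va = ⊕1-cyclic
  vortex-cyclic vb = ⊕1-cyclic
  vortex-cyclic vc = ⊕-1-cyclic
  vortex-cyclic vd = ⊕-1-cyclic

  rot-vtx : ∀ x → rot (vtx x) ≡ λ v → ord (unord v ⊕ disp (vor x))
  rot-vtx va = refl
  rot-vtx vb = refl
  rot-vtx vc = refl
  rot-vtx vd = refl

  rot-cyclic : ∀ u → CyclicOn (Adj p 4 u) (rot u)
  rot-cyclic u with view u
  ... | ordinary w = cyclicOn-transport (endpoint w) (currentTo w) (endpoint-adj w) (currentTo-valid w)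
                       (currentTo-endpoint w) (endpoint-currentTo w) (σ-cyclic N)
  ... | vortex x = subst (CyclicOn (Adj p 4 (vtx x))) (sym (rot-vtx x))
                     (cyclicOn-transport ord unord (λ w _ → adj-vtx-ord x w) (λ _ _ → tt)
                       (λ _ _ → refl) (ord-unord x) (vortex-cyclic x))

  rotation-system : RotationSystem p 4
  rotation-system = toRotationSystem rot rot-cyclic

  lift : Fin n → BaseDart → Dart p
  lift w (along c) = ord w , endpoint w c
  lift w (out x)   = vtx x , ord w

  shift : BaseDart → ℕ
  shift (along c) = disp c
  shift (out _)   = 0

  move : BaseDart → Fin n → Fin n
  move t w = w ⊕ shift t

  private
    φ-lift-ordinary : ∀ w c → Valid c → Ordinary c →
      φ rotation-system (ord w , ord (w ⊕ disp c)) ≡ (ord (w ⊕ disp c) , endpoint (w ⊕ disp c) (σ (reverse c)))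
    φ-lift-ordinary w c valid o = cong (λ c′ → ord (w ⊕ disp c) , endpoint (w ⊕ disp c) (σ c′)) (begin
      current (w ⊕ disp c) w           ≡⟨ current-reverse (⊕-disp-≢ w c valid o ∘ sym) ⟩
      reverse (current w (w ⊕ disp c)) ≡⟨ cong reverse (current-⊕ w c valid o) ⟩
      reverse c                       ∎)
      where open ≡-Reasoning

  φ-lift : ∀ w t → Good t → φ rotation-system (lift w t) ≡ lift (move t w) (next t)
  φ-lift w (along (pos r q)) valid = φ-lift-ordinary w (pos r q) valid tt
  φ-lift w (along (neg r q)) valid = φ-lift-ordinary w (neg r q) valid tt
  φ-lift w (along (vor x))   _     = cong (vtx x ,_) (cong-app (rot-vtx x) (ord w))
  φ-lift w (out x)           _     =
    trans (cong (λ c → ord w , endpoint w (σ c)) (currentTo-vtx w x))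
          (cong (λ w′ → ord w′ , endpoint w′ (σ (vor x))) (sym (⊕-identityʳ w)))

  lift-injective : ∀ {w w′ t t′} → Good t → Good t′ → lift w t ≡ lift w′ t′ → t ≡ t′
  lift-injective {w} {t = along c} {along c′} valid valid′ eq with refl ← ord-injective (cong proj₁ eq) =
    cong along (trans (sym (currentTo-endpoint w c valid)) (trans (cong (currentTo w ∘ proj₂) eq) (currentTo-endpoint w c′ valid′)))
  lift-injective {t = along c} {out x}   _ _ eq = ⊥-elim (vtx≢ord x _ (sym (cong proj₁ eq)))
  lift-injective {t = out x}   {along c} _ _ eq = ⊥-elim (vtx≢ord x _ (cong proj₁ eq))
  lift-injective {t = out x}   {out y}   _ _ eq = cong out (vtx-injective (cong proj₁ eq))
    where
    vortexAt : Fin p → Vortex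
    vortexAt zero             = va
    vortexAt (suc zero)       = vb
    vortexAt (suc (suc zero)) = vc
    vortexAt _                = vd
    vortexAt-vtx : ∀ x → vortexAt (vtx x) ≡ x
    vortexAt-vtx va = refl
    vortexAt-vtx vb = refl
    vortexAt-vtx vc = refl
    vortexAt-vtx vd = refl
    vtx-injective : ∀ {x y} → vtx x ≡ vtx y → x ≡ y
    vtx-injective {x} {y} eq = trans (sym (vortexAt-vtx x)) (trans (cong vortexAt eq) (vortexAt-vtx y))

  lift-onto : ∀ d → IsDart rotation-system d → ∃[ w ] ∃[ t ] Good t × lift w t ≡ d
  lift-onto (u , v) adj with view u
  ... | ordinary w = w , along (currentTo w v) , currentTo-valid w v adj , cong (ord w ,_) (endpoint-currentTo w v adj)
  ... | vortex x with view v
  ...   | vortex y   = ⊥-elim (¬adj-vtx-vtx x y adj)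
  ...   | ordinary w = w , out x , tt , refl

  open QuadrangularLift rotation-system lift move next Good next-good φ-lift lift-injective lift-onto

  wraps : BaseDart → ℕ
  wraps (along (neg _ _)) = 1
  wraps (along (vor vc))  = 1
  wraps (along (vor vd))  = 1
  wraps _                 = 0

  shift-balance : ∀ t → Good t → shift t + minusPart t ≡ plusPart t + wraps t * n
  shift-balance (along (pos r q)) _     = refl
  shift-balance (along (neg r q)) valid = trans (m∸n+n≡m (<⇒≤ (magnitude<n r q valid))) (sym (+-identityʳ n))
  shift-balance (along (vor va))  _     = refl
  shift-balance (along (vor vb))  _     = refl
  shift-balance (along (vor vc))  _     = trans (m∸n+n≡m (>-nonZero⁻¹ n)) (sym (+-identityʳ n))
  shift-balance (along (vor vd))  _     = trans (m∸n+n≡m (>-nonZero⁻¹ n)) (sym (+-identityʳ n))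
  shift-balance (out x)           _     = refl

  square-face : ∀ s → Good (Square.a s) → FaceOfLength4 (Square.a s)
  square-face s good-a = next⁴ , exact , closes
    where
    open Square s
    next² : iter next 2 a ≡ c
    next² = trans (cong next a→b) b→c
    next³ : iter next 3 a ≡ d
    next³ = trans (cong next next²) c→d
    next⁴ : iter next 4 a ≡ a
    next⁴ = trans (cong next next³) d→a
    exact : ∀ k → 0 < k → k < 4 → iter next k a ≢ a
    exact 1 _ _ eq = a≢b (sym (trans (sym a→b) eq))
    exact 2 _ _ eq = a≢c (sym (trans (sym next²) eq))
    exact 3 _ _ eq = a≢d (sym (trans (sym next³) eq))
    exact (suc (suc (suc (suc _)))) _ (s≤s (s≤s (s≤s (s≤s ())))) _
    good-b : Good b
    good-b = subst Good a→b (next-good a good-a)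
    good-c : Good c
    good-c = subst Good b→c (next-good b good-b)
    good-d : Good d
    good-d = subst Good c→d (next-good c good-c)
    closes : ∀ w → walk 4 a w ≡ w
    closes w = begin
      walk 4 a w                                         ≡⟨ cong (λ t → walk 3 t (move a w)) a→b ⟩
      walk 3 b (move a w)                                ≡⟨ cong (λ t → walk 2 t (move b (move a w))) b→c ⟩
      walk 2 c (move b (move a w))                       ≡⟨ cong (λ t → walk 1 t (move c (move b (move a w)))) c→d ⟩
      w ⊕ shift a ⊕ shift b ⊕ shift c ⊕ shift d          ≡⟨ cong (λ x → x ⊕ shift c ⊕ shift d) (⊕-⊕ w (shift a) (shift b)) ⟩
      w ⊕ (shift a + shift b) ⊕ shift c ⊕ shift d        ≡⟨ cong (_⊕ shift d) (⊕-⊕ w _ (shift c)) ⟩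
      w ⊕ (shift a + shift b + shift c) ⊕ shift d        ≡⟨ ⊕-⊕ w _ (shift d) ⟩
      w ⊕ (shift a + shift b + shift c + shift d)        ≡⟨ cong (w ⊕_) (balanced-sum n shift minusPart plusPart wraps a b c d
                                                              (shift-balance a good-a) (shift-balance b good-b)
                                                              (shift-balance c good-c) (shift-balance d good-d) balanced) ⟩
      w ⊕ (wraps a + wraps b + wraps c + wraps d) * n    ≡⟨ ⊕-multiple w (wraps a + wraps b + wraps c + wraps d) ⟩
      w                                                  ∎
      where open ≡-Reasoning

  quadrangular-embedding : Quadrangular rotation-system
  quadrangular-embedding = quadrangular λ t good →
    let s , a≡t = square-at t good in subst FaceOfLength4 a≡t (square-face s (subst Good (sym a≡t) good))

  vertex-count : p ≡ 8 * (2 + N) + 1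
  vertex-count = count N
    where count : ∀ N → 4 + suc (N * 4 + 6 + (N * 4 + 6)) ≡ 8 * (2 + N) + 1
          count = solve-∀

  embedded-in-genus : EmbeddedInGenus rotation-system (8 * N * N + 29 * N + 25)
  embedded-in-genus = genus-of-quadrangular rotation-system quadrangular-embedding (s≤s (s≤s (s≤s z≤n)))
    (8 * N * N + 29 * N + 25) (begin
    4 * p + 8 * (8 * N * N + 29 * N + 25)   ≡⟨ count N ⟩
    n * (n + 7) + 8                         ≡⟨ cong (_+ 8) (numDarts-K-K₄ n) ⟨
    numDarts p 4 + 8                        ∎)
    where
    open ≡-Reasoning
    count : ∀ N → let n = suc (N * 4 + 6 + (N * 4 + 6)) in
      4 * (4 + n) + 8 * (8 * N * N + 29 * N + 25) ≡ n * (n + 7) + 8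
    count = solve-∀

genus-value : ∀ N → let s = 2 + N in 8 * s * s ∸ 3 * s ∸ 1 ≡ 8 * N * N + 29 * N + 25
genus-value N = begin
  8 * s * s ∸ 3 * s ∸ 1        ≡⟨ cong (λ x → x ∸ 3 * s ∸ 1) (square N) ⟩
  H + 1 + 3 * s ∸ 3 * s ∸ 1    ≡⟨ cong (_∸ 1) (m+n∸n≡m (H + 1) (3 * s)) ⟩
  H + 1 ∸ 1                    ≡⟨ m+n∸n≡m H 1 ⟩
  H                            ∎
  where
  open ≡-Reasoning
  s H : ℕ
  s = 2 + N
  H = 8 * N * N + 29 * N + 25
  square : ∀ N → 8 * (2 + N) * (2 + N) ≡ 8 * N * N + 29 * N + 25 + 1 + 3 * (2 + N)
  square = solve-∀

lemma4 : (s : ℕ) → 2 ≤ s →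
    Σ (RotationSystem (8 * s + 1) 4) (λ R →
      Quadrangular R × EmbeddedInGenus R (8 * s * s ∸ 3 * s ∸ 1))
lemma4 (suc zero) (s≤s ())
lemma4 (suc (suc N)) _ =
  subst (λ p → Σ (RotationSystem p 4) λ R → Quadrangular R × EmbeddedInGenus R h) vertex-count
    (rotation-system , quadrangular-embedding , subst (EmbeddedInGenus rotation-system) (sym (genus-value N)) embedded-in-genus)
  where
  open Embedding N
  h : ℕ
  h = 8 * suc (suc N) * suc (suc N) ∸ 3 * suc (suc N) ∸ 1
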